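{- Let $f(n)$ be the number of distinct factors of length $2n$ of the Thue–Morse word $\mathbf t$ that are abelian squares. Then for every $n\ge 1$, $f(4^n-1)=(4^{n+1}-4)/3$ and $f(3\cdot 2^n)=14\cdot 2^n-4$.
   Context: The Thue–Morse word $\mathbf t=0110100110010110\cdots$ is the fixed point starting with $0$ of the morphism $\mu:0\mapsto 01,\ 1\mapsto 10$. An abelian square is a nonempty word $uv$ where $v$ is an anagram of $u$. -}

module Defs where

open import Data.Nat using (ℕ; zero; suc; _+_; _*_; _<_)
open import Data.Nat.DivMod using (_/_; _%_)
open import Data.Bool using (Bool; true; false; not)
open import Data.List using (List; []; _∷_; length; _++_; map; upTo)
open import Data.List.Relation.Binary.Permutation.Propositional using (_↭_)
open import Data.List.Membership.Propositional using (_∈_)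
open import Data.List.Relation.Unary.Unique.Propositional using (Unique)
open import Data.Product using (Σ; ∃; _×_)
open import Function.Bundles using (_⇔_)
open import Relation.Binary.PropositionalEquality using (_≡_)

-- The morphism μ : 0 ↦ 01, 1 ↦ 10  (0 = false, 1 = true)
μ : Bool → List Bool
μ b = b ∷ not b ∷ []

-- Thue–Morse letter at position n, via the fixed-point equations of μ:
-- t(2n) t(2n+1) = μ(t n), t 0 = 0.  Computed with fuel (fuel n suffices).
tmAux : ℕ → ℕ → Bool
tmAux zero    n = false
tmAux (suc k) zero = false
tmAux (suc k) (suc m) with (suc m) % 2
... | zero  = tmAux k ((suc m) / 2)
... | suc _ = not (tmAux k ((suc m) / 2))

thueMorse : ℕ → Bool
thueMorse n = tmAux n n

factorAt : ℕ → ℕ → List Bool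
factorAt i m = map (λ k → thueMorse (i + k)) (upTo m)

IsFactor : List Bool → Set
IsFactor w = ∃ λ i → factorAt i (length w) ≡ w

IsAbelianSquare : List Bool → Set
IsAbelianSquare w = Σ (List Bool) λ u → Σ (List Bool) λ v →
  (w ≡ u ++ v) × (u ↭ v) × (0 < length w)

-- f n ≡ N : the number of distinct factors of t of length 2n that are
-- abelian squares is N (i.e. these words are exactly the elements of a
-- duplicate-free list of length N).
CountAbSqFactors : ℕ → ℕ → Set
CountAbSqFactors n N = Σ (List (List Bool)) λ L →
  Unique L × length L ≡ N ×
  (∀ w → (w ∈ L) ⇔ (length w ≡ 2 * n × IsFactor w × IsAbelianSquare w))

-- Proof.  t(2^k q + s) = t(q) xor t(s) for s < 2^k (block structure), and a factor
-- of length L ≥ 6·2^k − 6 fixes the residue modulo 2^k of its occurrences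
-- (synchronization, by repeatedly desubstituting μ).  Hence at a scale B = 2^k
-- the factor of length 2m at B q + r is determined by r and by the short factor
-- of t at q covering the same blocks (transport), and the factors of length 2m
-- are counted residue by residue, running over one occurrence of each short
-- factor; these finitely many occurrences are certified by computation.  Being
-- an abelian square means that the prefix weights at i, i + m, i + 2m are in
-- arithmetic progression; since the prefix of length 2y has weight y, this is a
-- condition on two or three letters of t, which by the block structure becomes a
-- condition on t near q.  The counts per residue are then summed: for m = 3·2^n
-- directly, for m = 4^n − 1 with the help of the number of letter changes in the
-- prefix of length 2^(2n−3).

module Submission where

open import Defs
open import Data.Nat
open import Data.Nat.Properties
open import Data.Nat.DivMod using (m*n%n≡0; m*n/n≡m; [m+kn]%n≡m%n; +-distrib-/; m/n<m; m≡m%n+[m/n]*n; m%n<n; m/n*n≤m; m<n⇒m%n≡m)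
open import Data.Nat.Tactic.RingSolver using (solve-∀)
open import Data.Bool using (Bool; true; false; not; _xor_; _∧_; T)
open import Data.Bool.Properties using (not-involutive; xor-assoc; xor-comm; xor-identityʳ; xor-same; xor-∧-commutativeRing)
  renaming (_≟_ to _≟ᵇ_)
open import Data.Product using (Σ; _×_; _,_; proj₁; proj₂)
open import Data.Sum using (inj₁; inj₂)
open import Function.Bundles using (mk⇔)
open import Data.List using (List; []; _∷_; length; _++_; map; applyUpTo; upTo; replicate; filterᵇ)
open import Data.List.Properties using (length-++; length-map; map-++; ∷-injective; ≡-dec; filter-≐)
open import Data.List.Relation.Unary.All as All using (All)
open import Data.List.Relation.Unary.Any as Any using (Any)
open import Data.List.Relation.Unary.AllPairs as AllPairs using (AllPairs)
open import Data.List.Membership.Propositional using (_∈_; find)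
open import Data.List.Relation.Unary.Unique.Propositional using (Unique)
open import Data.List.Membership.Propositional.Properties using (∈-upTo⁺; ∈-map⁺; ∈-map⁻; ∈-++⁺ˡ; ∈-++⁺ʳ; ∈-++⁻; ∈-filter⁺; ∈-filter⁻)
import Data.List.Relation.Unary.AllPairs.Properties as AllPairs
open import Data.List.Relation.Binary.Permutation.Propositional using (_↭_; ↭-refl; ↭-trans; ↭-sym; prep)
open import Data.List.Relation.Binary.Permutation.Propositional.Properties using (↭-length; map⁺; shift)
open import Data.Nat.ListAction using (sum)
open import Data.Nat.ListAction.Properties using (sum-++; sum-↭)
open import Data.Empty using (⊥; ⊥-elim)
open import Algebra.Bundles using (CommutativeRing)
open import Algebra.Properties.CommutativeSemigroup (CommutativeRing.+-commutativeSemigroup xor-∧-commutativeRing)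
  using () renaming (interchange to xor-interchange)
open import Relation.Nullary using (Dec; ¬?)
open import Relation.Nullary.Decidable using (T?; True; toWitness)
open import Relation.Binary.PropositionalEquality
open import Function using (_∘_; id)

t : ℕ → Bool
t = thueMorse

flipIf : ℕ → Bool → Bool
flipIf zero    b = b
flipIf (suc _) b = not b

tmAux-step : ∀ k m → tmAux (suc k) (suc m) ≡ flipIf (suc m % 2) (tmAux k (suc m / 2))
tmAux-step k m with suc m % 2
... | zero  = refl
... | suc _ = refl

tmAux-fuel : ∀ a b n → n ≤ a → n ≤ b → tmAux a n ≡ tmAux b n
tmAux-fuel zero    zero    n       _       _       = refl
tmAux-fuel zero    (suc b) zero    _       _       = refl
tmAux-fuel (suc a) zero    zero    _       _       = refl
tmAux-fuel (suc a) (suc b) zero    _       _       = refl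
tmAux-fuel (suc a) (suc b) (suc m) (s≤s p) (s≤s q) = begin
    tmAux (suc a) (suc m)                       ≡⟨ tmAux-step a m ⟩
    flipIf (suc m % 2) (tmAux a (suc m / 2))    ≡⟨ cong (flipIf (suc m % 2)) (tmAux-fuel a b _ (≤-trans half≤m p) (≤-trans half≤m q)) ⟩
    flipIf (suc m % 2) (tmAux b (suc m / 2))    ≡⟨ tmAux-step b m ⟨
    tmAux (suc b) (suc m)                       ∎
  where
  open ≡-Reasoning
  half≤m : suc m / 2 ≤ m
  half≤m = ≤-pred (m/n<m (suc m) 2 (s≤s (s≤s z≤n)))

tmAux≡t : ∀ a n → n ≤ a → tmAux a n ≡ t n
tmAux≡t a n p = tmAux-fuel a n n p ≤-refl

t-double : ∀ y → t (y * 2) ≡ t y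
t-double zero    = refl
t-double (suc y) = begin
    tmAux (suc (suc (y * 2))) (suc (suc (y * 2)))
  ≡⟨ tmAux-step (suc (y * 2)) (suc (y * 2)) ⟩
    flipIf ((suc y * 2) % 2) (tmAux (suc (y * 2)) ((suc y * 2) / 2))
  ≡⟨ cong₂ flipIf (m*n%n≡0 (suc y) 2) (cong (tmAux (suc (y * 2))) (m*n/n≡m (suc y) 2)) ⟩
    tmAux (suc (y * 2)) (suc y)
  ≡⟨ tmAux≡t _ (suc y) (s≤s (m≤m*n y 2)) ⟩
    t (suc y) ∎
  where open ≡-Reasoning

t-double+1 : ∀ y → t (1 + y * 2) ≡ not (t y)
t-double+1 y = begin
    tmAux (suc (y * 2)) (suc (y * 2))
  ≡⟨ tmAux-step (y * 2) (y * 2) ⟩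
    flipIf ((1 + y * 2) % 2) (tmAux (y * 2) ((1 + y * 2) / 2))
  ≡⟨ cong₂ flipIf ([m+kn]%n≡m%n 1 y 2) (cong (tmAux (y * 2)) half) ⟩
    not (tmAux (y * 2) y)
  ≡⟨ cong not (tmAux≡t _ y (m≤m*n y 2)) ⟩
    not (t y) ∎
  where
  open ≡-Reasoning
  half : (1 + y * 2) / 2 ≡ y
  half = trans (+-distrib-/ 1 (y * 2) (subst (λ z → 1 + z < 2) (sym (m*n%n≡0 y 2)) (s≤s (s≤s z≤n))))
               (m*n/n≡m y 2)

bitValue : Bool → ℕ
bitValue false = 0
bitValue true  = 1

lowBit : ℕ → Bool
lowBit zero          = false
lowBit (suc zero)    = true
lowBit (suc (suc n)) = lowBit n

bitValue≤1 : ∀ b → bitValue b ≤ 1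
bitValue≤1 false = z≤n
bitValue≤1 true  = s≤s z≤n

binary-split : ∀ s → s ≡ bitValue (lowBit s) + ⌊ s /2⌋ * 2
binary-split zero          = refl
binary-split (suc zero)    = refl
binary-split (suc (suc n)) = trans (cong (2 +_) (binary-split n)) (arith (bitValue (lowBit n)) ⌊ n /2⌋)
  where
  arith : ∀ b h → 2 + (b + h * 2) ≡ b + suc h * 2
  arith = solve-∀

t-digit : ∀ b h → t (bitValue b + h * 2) ≡ b xor t h
t-digit false h = t-double h
t-digit true  h = t-double+1 h

half<2^k : ∀ s k → s < 2 ^ suc k → ⌊ s /2⌋ < 2 ^ k
half<2^k s k s<2^k+1 = *-cancelʳ-< 2 ⌊ s /2⌋ (2 ^ k) (begin-strict
    ⌊ s /2⌋ * 2                            ≤⟨ m≤n+m _ (bitValue (lowBit s)) ⟩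
    bitValue (lowBit s) + ⌊ s /2⌋ * 2      ≡⟨ binary-split s ⟨
    s                                      <⟨ s<2^k+1 ⟩
    2 * 2 ^ k                              ≡⟨ *-comm 2 (2 ^ k) ⟩
    2 ^ k * 2                              ∎)
  where open ≤-Reasoning

t-block : ∀ k q s → s < 2 ^ k → t (2 ^ k * q + s) ≡ t q xor t s
t-block zero    q zero    _       = trans (cong t (trans (+-identityʳ _) (*-identityˡ q))) (sym (xor-identityʳ (t q)))
t-block zero    q (suc s) (s≤s ())
t-block (suc k) q s       s<2^k+1 = begin
    t (2 ^ suc k * q + s)
  ≡⟨ cong (λ z → t (2 ^ suc k * q + z)) (binary-split s) ⟩
    t (2 * 2 ^ k * q + (b + h * 2))
  ≡⟨ cong t (regroup (2 ^ k) q b h) ⟩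
    t (b + (2 ^ k * q + h) * 2)
  ≡⟨ t-digit (lowBit s) (2 ^ k * q + h) ⟩
    lowBit s xor t (2 ^ k * q + h)
  ≡⟨ cong (lowBit s xor_) (t-block k q h h<2^k) ⟩
    lowBit s xor (t q xor t h)
  ≡⟨ sym (xor-assoc (lowBit s) (t q) (t h)) ⟩
    (lowBit s xor t q) xor t h
  ≡⟨ cong (_xor t h) (xor-comm (lowBit s) (t q)) ⟩
    (t q xor lowBit s) xor t h
  ≡⟨ xor-assoc (t q) (lowBit s) (t h) ⟩
    t q xor (lowBit s xor t h)
  ≡⟨ cong (t q xor_) (trans (sym (t-digit (lowBit s) h)) (cong t (sym (binary-split s)))) ⟩
    t q xor t s ∎
  where
  open ≡-Reasoning
  b : ℕ
  b = bitValue (lowBit s)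
  h : ℕ
  h = ⌊ s /2⌋
  regroup : ∀ P q b h → 2 * P * q + (b + h * 2) ≡ b + (P * q + h) * 2
  regroup = solve-∀
  h<2^k : h < 2 ^ k
  h<2^k = half<2^k s k s<2^k+1

factor : ℕ → ℕ → List Bool
factor i zero    = []
factor i (suc m) = t i ∷ factor (suc i) m

map-applyUpTo≡factor : ∀ (g : ℕ → Bool) (f : ℕ → ℕ) i m →
                       (∀ k → g (f k) ≡ t (i + k)) → map g (applyUpTo f m) ≡ factor i m
map-applyUpTo≡factor g f i zero    _   = refl
map-applyUpTo≡factor g f i (suc m) g∘f = cong₂ _∷_ (trans (g∘f 0) (cong t (+-identityʳ i)))
  (map-applyUpTo≡factor g (f ∘ suc) (suc i) m (λ k → trans (g∘f (suc k)) (cong t (+-suc i k))))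

factorAt≡factor : ∀ i m → factorAt i m ≡ factor i m
factorAt≡factor i m = map-applyUpTo≡factor (λ k → t (i + k)) id i m (λ _ → refl)

length-factor : ∀ i m → length (factor i m) ≡ m
length-factor i zero    = refl
length-factor i (suc m) = cong suc (length-factor (suc i) m)

factor-++ : ∀ i a b → factor i (a + b) ≡ factor i a ++ factor (i + a) b
factor-++ i zero    b = cong (λ z → factor z b) (sym (+-identityʳ i))
factor-++ i (suc a) b = cong (t i ∷_) (trans (factor-++ (suc i) a b) (cong (λ z → factor (suc i) a ++ factor z b) (sym (+-suc i a))))

factor-letter : ∀ i j L s → factor i L ≡ factor j L → s < L → t (i + s) ≡ t (j + s)
factor-letter i j (suc L) zero    eq _       =
  trans (cong t (+-identityʳ i)) (trans (proj₁ (∷-injective eq)) (cong t (sym (+-identityʳ j))))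
factor-letter i j (suc L) (suc s) eq (s≤s s<L) =
  trans (cong t (+-suc i s)) (trans (factor-letter (suc i) (suc j) L s (proj₂ (∷-injective eq)) s<L) (cong t (sym (+-suc j s))))

factor-ext : ∀ i j L → (∀ s → s < L → t (i + s) ≡ t (j + s)) → factor i L ≡ factor j L
factor-ext i j zero    _       = refl
factor-ext i j (suc L) letters = cong₂ _∷_
  (trans (cong t (sym (+-identityʳ i))) (trans (letters 0 (s≤s z≤n)) (cong t (+-identityʳ j))))
  (factor-ext (suc i) (suc j) L (λ s s<L → trans (cong t (sym (+-suc i s))) (trans (letters (suc s) (s≤s s<L)) (cong t (+-suc j s)))))

ones : List Bool → ℕ
ones u = sum (map bitValue u)

ones-++ : ∀ u v → ones (u ++ v) ≡ ones u + ones v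
ones-++ u v = trans (cong sum (map-++ bitValue u v)) (sum-++ (map bitValue u) (map bitValue v))

prefixOnes : ℕ → ℕ
prefixOnes x = ones (factor 0 x)

ones-factor : ∀ i m → ones (factor i m) + prefixOnes i ≡ prefixOnes (i + m)
ones-factor i m = begin
  ones (factor i m) + prefixOnes i             ≡⟨ +-comm (ones (factor i m)) (prefixOnes i) ⟩
  prefixOnes i + ones (factor i m)             ≡⟨ ones-++ (factor 0 i) (factor i m) ⟨
  ones (factor 0 i ++ factor i m)              ≡⟨ cong ones (factor-++ 0 i m) ⟨
  prefixOnes (i + m)                           ∎
  where open ≡-Reasoning

-- Since t(2y) t(2y+1) is 01 or 10, the prefix of length 2y has exactly y ones.
prefixOnes-double : ∀ y → prefixOnes (y * 2) ≡ y
prefixOnes-double zero    = refl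
prefixOnes-double (suc y) = begin
    prefixOnes (suc y * 2)                         ≡⟨ cong prefixOnes (+-comm 2 (y * 2)) ⟩
    prefixOnes (y * 2 + 2)                         ≡⟨ ones-factor (y * 2) 2 ⟨
    ones (factor (y * 2) 2) + prefixOnes (y * 2)   ≡⟨ cong₂ _+_ one-in-pair (prefixOnes-double y) ⟩
    1 + y                                          ∎
  where
  open ≡-Reasoning
  complementary : ∀ b → bitValue b + (bitValue (not b) + 0) ≡ 1
  complementary false = refl
  complementary true  = refl
  one-in-pair : ones (factor (y * 2) 2) ≡ 1
  one-in-pair = trans (cong₂ (λ a b → bitValue a + (bitValue b + 0)) (t-double y) (t-double+1 y)) (complementary (t y))

prefixOnes-double+1 : ∀ y → prefixOnes (1 + y * 2) ≡ y + bitValue (t y)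
prefixOnes-double+1 y = begin
    prefixOnes (1 + y * 2)                          ≡⟨ cong prefixOnes (+-comm 1 (y * 2)) ⟩
    prefixOnes (y * 2 + 1)                          ≡⟨ ones-factor (y * 2) 1 ⟨
    (bitValue (t (y * 2)) + 0) + prefixOnes (y * 2) ≡⟨ cong₂ (λ a b → (bitValue a + 0) + b) (t-double y) (prefixOnes-double y) ⟩
    (bitValue (t y) + 0) + y                        ≡⟨ +-comm (bitValue (t y) + 0) y ⟩
    y + (bitValue (t y) + 0)                        ≡⟨ cong (y +_) (+-identityʳ _) ⟩
    y + bitValue (t y)                              ∎
  where open ≡-Reasoning

zeros : List Bool → ℕ
zeros []           = 0
zeros (true  ∷ bs) = zeros bs
zeros (false ∷ bs) = suc (zeros bs)

sorted : List Bool → List Bool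
sorted u = replicate (ones u) true ++ replicate (zeros u) false

↭-sorted : ∀ u → u ↭ sorted u
↭-sorted []          = ↭-refl
↭-sorted (true  ∷ u) = prep true (↭-sorted u)
↭-sorted (false ∷ u) = ↭-trans (prep false (↭-sorted u)) (↭-sym (shift false (replicate (ones u) true) (replicate (zeros u) false)))

length≡ones+zeros : ∀ u → length u ≡ ones u + zeros u
length≡ones+zeros []          = refl
length≡ones+zeros (true  ∷ u) = cong suc (length≡ones+zeros u)
length≡ones+zeros (false ∷ u) = trans (cong suc (length≡ones+zeros u)) (sym (+-suc (ones u) (zeros u)))

↭⇒ones≡ : ∀ {u v} → u ↭ v → ones u ≡ ones v
↭⇒ones≡ u↭v = sum-↭ (map⁺ bitValue u↭v)

-- Words of the same length and weight are anagrams: both sort to the same word.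
ones≡⇒↭ : ∀ u v → length u ≡ length v → ones u ≡ ones v → u ↭ v
ones≡⇒↭ u v |u|≡|v| ones≡ = ↭-trans (↭-sorted u) (subst (_↭ v) (sym same-sorted) (↭-sym (↭-sorted v)))
  where
  zeros≡ : zeros u ≡ zeros v
  zeros≡ = +-cancelˡ-≡ (ones u) (zeros u) (zeros v)
    (trans (sym (length≡ones+zeros u)) (trans |u|≡|v| (trans (length≡ones+zeros v) (cong (_+ zeros v) (sym ones≡)))))
  same-sorted : sorted u ≡ sorted v
  same-sorted = cong₂ (λ a b → replicate a true ++ replicate b false) ones≡ zeros≡

abSqAt : ℕ → ℕ → Bool
abSqAt m i = ones (factor i m) ≡ᵇ ones (factor (i + m) m)

factor-square : ∀ i m → factor i (2 * m) ≡ factor i m ++ factor (i + m) m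
factor-square i m = trans (factor-++ i m (m + 0)) (cong (λ z → factor i m ++ factor (i + m) z) (+-identityʳ m))

++-split : ∀ {A : Set} (u v x y : List A) → u ++ v ≡ x ++ y → length u ≡ length x → u ≡ x × v ≡ y
++-split []      v []      y eq _       = refl , eq
++-split (a ∷ u) v (b ∷ x) y eq |u|≡|x| with ∷-injective eq
... | refl , eq′ with ++-split u v x y eq′ (suc-injective |u|≡|x|)
... | refl , refl = refl , refl

abSqAt-sound : ∀ m i → 0 < m → T (abSqAt m i) → IsAbelianSquare (factor i (2 * m))
abSqAt-sound m i 0<m test = factor i m , factor (i + m) m , factor-square i m ,
  ones≡⇒↭ _ _ (trans (length-factor i m) (sym (length-factor (i + m) m))) (≡ᵇ⇒≡ _ _ test) ,
  subst (0 <_) (sym (length-factor i (2 * m))) (≤-trans 0<m (m≤m+n m (m + 0)))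

-- Conversely, an abelian-square factor has anagram halves of length m each,
-- which must be the two halves cut by the test.
abSqAt-complete : ∀ m i → IsAbelianSquare (factor i (2 * m)) → T (abSqAt m i)
abSqAt-complete m i (u , v , eq , u↭v , _) =
  ≡⇒≡ᵇ _ _ (trans (cong ones (sym u≡)) (trans (↭⇒ones≡ u↭v) (cong ones v≡)))
  where
  |u|+|u| : length u + length u ≡ m + m
  |u|+|u| = begin
    length u + length u        ≡⟨ cong (length u +_) (↭-length u↭v) ⟩
    length u + length v        ≡⟨ length-++ u ⟨
    length (u ++ v)            ≡⟨ cong length eq ⟨
    length (factor i (2 * m))  ≡⟨ length-factor i (2 * m) ⟩
    m + (m + 0)                ≡⟨ cong (m +_) (+-identityʳ m) ⟩
    m + m                      ∎
    where open ≡-Reasoning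
  |u|≡m : length u ≡ m
  |u|≡m = *-cancelˡ-≡ (length u) m 2
    (trans (cong (length u +_) (+-identityʳ (length u))) (trans |u|+|u| (cong (m +_) (sym (+-identityʳ m)))))
  halves : u ≡ factor i m × v ≡ factor (i + m) m
  halves = ++-split u v (factor i m) (factor (i + m) m) (trans (sym eq) (factor-square i m))
                    (trans |u|≡m (sym (length-factor i m)))
  u≡ : u ≡ factor i m
  u≡ = proj₁ halves
  v≡ : v ≡ factor (i + m) m
  v≡ = proj₂ halves

abSqAt-factor : ∀ m i j → factor i (2 * m) ≡ factor j (2 * m) → abSqAt m i ≡ abSqAt m j
abSqAt-factor m i j eq with ++-split (factor i m) (factor (i + m) m) (factor j m) (factor (j + m) m)
                                    (trans (sym (factor-square i m)) (trans eq (factor-square j m)))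
                                    (trans (length-factor i m) (sym (length-factor j m)))
... | eq₁ , eq₂ = cong₂ (λ a b → ones a ≡ᵇ ones b) eq₁ eq₂

≡ᵇ-cancelˡ : ∀ p x y → (p + x ≡ᵇ p + y) ≡ (x ≡ᵇ y)
≡ᵇ-cancelˡ zero    x y = refl
≡ᵇ-cancelˡ (suc p) x y = ≡ᵇ-cancelˡ p x y

≡ᵇ-shift : ∀ p x y {u v} → p + x ≡ u → p + y ≡ v → (u ≡ᵇ v) ≡ (x ≡ᵇ y)
≡ᵇ-shift p x y refl refl = ≡ᵇ-cancelˡ p x y

abSqAt-prefix : ∀ m i →
  abSqAt m i ≡ (prefixOnes (i + m) + prefixOnes (i + m) ≡ᵇ prefixOnes i + prefixOnes (i + m + m))
abSqAt-prefix m i = sym (≡ᵇ-shift (prefixOnes i + prefixOnes (i + m)) (ones (factor i m)) (ones (factor (i + m) m)) left right)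
  where
  open ≡-Reasoning
  left : prefixOnes i + prefixOnes (i + m) + ones (factor i m) ≡ prefixOnes (i + m) + prefixOnes (i + m)
  left = begin
    prefixOnes i + prefixOnes (i + m) + ones (factor i m)   ≡⟨ arith (prefixOnes i) (prefixOnes (i + m)) (ones (factor i m)) ⟩
    prefixOnes (i + m) + (ones (factor i m) + prefixOnes i) ≡⟨ cong (prefixOnes (i + m) +_) (ones-factor i m) ⟩
    prefixOnes (i + m) + prefixOnes (i + m)                 ∎
    where
    arith : ∀ a b o → a + b + o ≡ b + (o + a)
    arith = solve-∀
  right : prefixOnes i + prefixOnes (i + m) + ones (factor (i + m) m) ≡ prefixOnes i + prefixOnes (i + m + m)
  right = trans (+-assoc (prefixOnes i) _ _)
    (cong (prefixOnes i +_) (trans (+-comm (prefixOnes (i + m)) _) (ones-factor (i + m) m)))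

-- Writing T(x) for the letter t x as a number, prefixOnes(2y) = y and
-- prefixOnes(2y+1) = y + T(y) turn the progression condition into a condition on
-- at most three letters of t.

sameBit : Bool → Bool → Bool
sameBit a b = not (a xor b)

sameBit-xor : ∀ a b c → sameBit (a xor c) (b xor c) ≡ sameBit a b
sameBit-xor a     b     false = cong₂ sameBit (xor-identityʳ a) (xor-identityʳ b)
sameBit-xor false false true  = refl
sameBit-xor false true  true  = refl
sameBit-xor true  false true  = refl
sameBit-xor true  true  true  = refl

-- Even position, even half-length 2M: the weights y, y + M, y + 2M are always in
-- progression, so every such factor is an abelian square.
abSqAt-even-even : ∀ M y → abSqAt (M * 2) (y * 2) ≡ true
abSqAt-even-even M y = trans (abSqAt-prefix (M * 2) (y * 2)) (≡ᵇ-shift (y + M + y + M) 0 0 left right)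
  where
  mid : prefixOnes (y * 2 + M * 2) ≡ y + M
  mid = trans (cong prefixOnes (sym (*-distribʳ-+ 2 y M))) (prefixOnes-double (y + M))
  end : prefixOnes (y * 2 + M * 2 + M * 2) ≡ y + M + M
  end = trans (cong prefixOnes (position y M)) (prefixOnes-double (y + M + M))
    where
    position : ∀ y M → y * 2 + M * 2 + M * 2 ≡ (y + M + M) * 2
    position = solve-∀
  left : y + M + y + M + 0 ≡ prefixOnes (y * 2 + M * 2) + prefixOnes (y * 2 + M * 2)
  left = trans (arith y M) (sym (cong₂ _+_ mid mid))
    where
    arith : ∀ y M → y + M + y + M + 0 ≡ (y + M) + (y + M)
    arith = solve-∀
  right : y + M + y + M + 0 ≡ prefixOnes (y * 2) + prefixOnes (y * 2 + M * 2 + M * 2)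
  right = trans (arith y M) (sym (cong₂ _+_ (prefixOnes-double y) end))
    where
    arith : ∀ y M → y + M + y + M + 0 ≡ y + (y + M + M)
    arith = solve-∀

abSqAt-odd-even : ∀ M y → abSqAt (M * 2) (1 + y * 2) ≡
                  (sameBit (t y) (t (y + M)) ∧ sameBit (t (y + M)) (t (y + M + M)))
abSqAt-odd-even M y = trans (abSqAt-prefix (M * 2) (1 + y * 2))
  (trans (≡ᵇ-shift (y + M + y + M) (T₁ + T₁) (T₀ + T₂) left right) (constant (t y) (t (y + M)) (t (y + M + M))))
  where
  T₀ : ℕ
  T₀ = bitValue (t y)
  T₁ : ℕ
  T₁ = bitValue (t (y + M))
  T₂ : ℕ
  T₂ = bitValue (t (y + M + M))
  mid : prefixOnes (1 + y * 2 + M * 2) ≡ y + M + T₁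
  mid = trans (cong prefixOnes (position y M)) (prefixOnes-double+1 (y + M))
    where
    position : ∀ y M → 1 + y * 2 + M * 2 ≡ 1 + (y + M) * 2
    position = solve-∀
  end : prefixOnes (1 + y * 2 + M * 2 + M * 2) ≡ y + M + M + T₂
  end = trans (cong prefixOnes (position y M)) (prefixOnes-double+1 (y + M + M))
    where
    position : ∀ y M → 1 + y * 2 + M * 2 + M * 2 ≡ 1 + (y + M + M) * 2
    position = solve-∀
  left : y + M + y + M + (T₁ + T₁) ≡ prefixOnes (1 + y * 2 + M * 2) + prefixOnes (1 + y * 2 + M * 2)
  left = trans (arith y M T₁) (sym (cong₂ _+_ mid mid))
    where
    arith : ∀ y M a → y + M + y + M + (a + a) ≡ (y + M + a) + (y + M + a)
    arith = solve-∀
  right : y + M + y + M + (T₀ + T₂) ≡ prefixOnes (1 + y * 2) + prefixOnes (1 + y * 2 + M * 2 + M * 2)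
  right = trans (arith y M T₀ T₂) (sym (cong₂ _+_ (prefixOnes-double+1 y) end))
    where
    arith : ∀ y M a c → y + M + y + M + (a + c) ≡ (y + a) + (y + M + M + c)
    arith = solve-∀
  constant : ∀ a b c → (bitValue b + bitValue b ≡ᵇ bitValue a + bitValue c) ≡ (sameBit a b ∧ sameBit b c)
  constant false false false = refl
  constant false false true  = refl
  constant false true  false = refl
  constant false true  true  = refl
  constant true  false false = refl
  constant true  false true  = refl
  constant true  true  false = refl
  constant true  true  true  = refl

-- Even position, odd half-length 2M + 1: never an abelian square, as the weight
-- progression would need 2·t(y + M) = 1.
abSqAt-even-odd : ∀ M y → abSqAt (1 + M * 2) (y * 2) ≡ false
abSqAt-even-odd M y = trans (abSqAt-prefix (1 + M * 2) (y * 2))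
  (trans (≡ᵇ-shift (y + M + y + M) (T₁ + T₁) 1 left right) (twice≢1 (t (y + M))))
  where
  T₁ : ℕ
  T₁ = bitValue (t (y + M))
  mid : prefixOnes (y * 2 + (1 + M * 2)) ≡ y + M + T₁
  mid = trans (cong prefixOnes (position y M)) (prefixOnes-double+1 (y + M))
    where
    position : ∀ y M → y * 2 + (1 + M * 2) ≡ 1 + (y + M) * 2
    position = solve-∀
  end : prefixOnes (y * 2 + (1 + M * 2) + (1 + M * 2)) ≡ y + M + M + 1
  end = trans (cong prefixOnes (position y M)) (prefixOnes-double (y + M + M + 1))
    where
    position : ∀ y M → y * 2 + (1 + M * 2) + (1 + M * 2) ≡ (y + M + M + 1) * 2
    position = solve-∀
  left : y + M + y + M + (T₁ + T₁) ≡ prefixOnes (y * 2 + (1 + M * 2)) + prefixOnes (y * 2 + (1 + M * 2))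
  left = trans (arith y M T₁) (sym (cong₂ _+_ mid mid))
    where
    arith : ∀ y M a → y + M + y + M + (a + a) ≡ (y + M + a) + (y + M + a)
    arith = solve-∀
  right : y + M + y + M + 1 ≡ prefixOnes (y * 2) + prefixOnes (y * 2 + (1 + M * 2) + (1 + M * 2))
  right = trans (arith y M) (sym (cong₂ _+_ (prefixOnes-double y) end))
    where
    arith : ∀ y M → y + M + y + M + 1 ≡ y + (y + M + M + 1)
    arith = solve-∀
  twice≢1 : ∀ a → (bitValue a + bitValue a ≡ᵇ 1) ≡ false
  twice≢1 false = refl
  twice≢1 true  = refl

abSqAt-odd-odd : ∀ M y → abSqAt (1 + M * 2) (1 + y * 2) ≡ t y xor t (y + M + M + 1)
abSqAt-odd-odd M y = trans (abSqAt-prefix (1 + M * 2) (1 + y * 2))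
  (trans (≡ᵇ-shift (y + M + y + M + 1) 1 (T₀ + T₂) left right) (sum≡1 (t y) (t (y + M + M + 1))))
  where
  T₀ : ℕ
  T₀ = bitValue (t y)
  T₂ : ℕ
  T₂ = bitValue (t (y + M + M + 1))
  mid : prefixOnes (1 + y * 2 + (1 + M * 2)) ≡ y + M + 1
  mid = trans (cong prefixOnes (position y M)) (prefixOnes-double (y + M + 1))
    where
    position : ∀ y M → 1 + y * 2 + (1 + M * 2) ≡ (y + M + 1) * 2
    position = solve-∀
  end : prefixOnes (1 + y * 2 + (1 + M * 2) + (1 + M * 2)) ≡ y + M + M + 1 + T₂
  end = trans (cong prefixOnes (position y M)) (prefixOnes-double+1 (y + M + M + 1))
    where
    position : ∀ y M → 1 + y * 2 + (1 + M * 2) + (1 + M * 2) ≡ 1 + (y + M + M + 1) * 2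
    position = solve-∀
  left : y + M + y + M + 1 + 1 ≡ prefixOnes (1 + y * 2 + (1 + M * 2)) + prefixOnes (1 + y * 2 + (1 + M * 2))
  left = trans (arith y M) (sym (cong₂ _+_ mid mid))
    where
    arith : ∀ y M → y + M + y + M + 1 + 1 ≡ (y + M + 1) + (y + M + 1)
    arith = solve-∀
  right : y + M + y + M + 1 + (T₀ + T₂) ≡ prefixOnes (1 + y * 2) + prefixOnes (1 + y * 2 + (1 + M * 2) + (1 + M * 2))
  right = trans (arith y M T₀ T₂) (sym (cong₂ _+_ (prefixOnes-double+1 y) end))
    where
    arith : ∀ y M a c → y + M + y + M + 1 + (a + c) ≡ (y + a) + (y + M + M + 1 + c)
    arith = solve-∀
  sum≡1 : ∀ a c → (1 ≡ᵇ bitValue a + bitValue c) ≡ a xor c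
  sum≡1 false false = refl
  sum≡1 false true  = refl
  sum≡1 true  false = refl
  sum≡1 true  true  = refl

b≢not-b : ∀ b → b ≢ not b
b≢not-b false ()
b≢not-b true  ()

t-pair : ∀ h → t (1 + h * 2) ≡ not (t (h * 2))
t-pair h = trans (t-double+1 h) (cong not (sym (t-double h)))

-- Two consecutive letters starting at an even position differ, so t has no cube bbb.
no-cube : ∀ a → t a ≡ t (1 + a) → t (1 + a) ≡ t (2 + a) → ⊥
no-cube a eq₁ eq₂ with lowBit a | binary-split a
... | false | a≡ = b≢not-b (t (⌊ a /2⌋ * 2))
  (trans (cong t (sym a≡)) (trans eq₁ (trans (cong (λ z → t (1 + z)) a≡) (t-pair ⌊ a /2⌋))))
... | true  | a≡ = b≢not-b (t (suc ⌊ a /2⌋ * 2))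
  (trans (cong (λ z → t (1 + z)) (sym a≡)) (trans eq₂ (trans (cong (λ z → t (2 + z)) a≡) (t-pair (suc ⌊ a /2⌋)))))

alternate-even : ∀ h s → t (h * 2 + (1 + s * 2)) ≡ not (t (h * 2 + s * 2))
alternate-even h s = trans (cong t (position h s)) (trans (t-pair (h + s)) (cong not (cong t (*-distribʳ-+ 2 h s))))
  where
  position : ∀ h s → h * 2 + (1 + s * 2) ≡ 1 + (h + s) * 2
  position = solve-∀

alternate-odd : ∀ g s → t (1 + g * 2 + (2 + s * 2)) ≡ not (t (1 + g * 2 + (1 + s * 2)))
alternate-odd g s = trans (cong t (position₁ g s)) (trans (t-pair (g + s + 1)) (cong not (cong t (sym (position₂ g s)))))
  where
  position₁ : ∀ g s → 1 + g * 2 + (2 + s * 2) ≡ 1 + (g + s + 1) * 2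
  position₁ = solve-∀
  position₂ : ∀ g s → 1 + g * 2 + (1 + s * 2) ≡ (g + s + 1) * 2
  position₂ = solve-∀

-- A factor of length 5 cannot occur both at an even and at an odd position:
-- its letters 0, 2, 4 would be equal, giving a cube t(h) t(h+1) t(h+2).
even-odd-disjoint : ∀ h g L → 5 ≤ L → factor (h * 2) L ≡ factor (1 + g * 2) L → ⊥
even-odd-disjoint h g L 5≤L eq = no-cube h (trans (sym w₀) (trans w₀≡w₂ w₂)) (trans (sym w₂) (trans w₂≡w₄ w₄))
  where
  w : ℕ → Bool
  w s = t (h * 2 + s)
  same : ∀ s → s < 5 → w s ≡ t (1 + g * 2 + s)
  same s s<5 = factor-letter (h * 2) (1 + g * 2) L s eq (≤-trans s<5 5≤L)
  w₂≡¬w₁ : w 2 ≡ not (w 1)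
  w₂≡¬w₁ = trans (same 2 (s≤s (s≤s (s≤s z≤n)))) (trans (alternate-odd g 0) (cong not (sym (same 1 (s≤s (s≤s z≤n))))))
  w₄≡¬w₃ : w 4 ≡ not (w 3)
  w₄≡¬w₃ = trans (same 4 ≤-refl) (trans (alternate-odd g 1) (cong not (sym (same 3 (s≤s (s≤s (s≤s (s≤s z≤n))))))))
  flip-flip : ∀ {a b c} → b ≡ not a → c ≡ not b → a ≡ c
  flip-flip {a} refl refl = sym (not-involutive a)
  w₀≡w₂ : w 0 ≡ w 2
  w₀≡w₂ = flip-flip (alternate-even h 0) w₂≡¬w₁
  w₂≡w₄ : w 2 ≡ w 4
  w₂≡w₄ = flip-flip (alternate-even h 1) w₄≡¬w₃
  w₀ : w 0 ≡ t h
  w₀ = trans (cong t (+-identityʳ (h * 2))) (t-double h)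
  w₂ : w 2 ≡ t (1 + h)
  w₂ = trans (cong t (+-comm (h * 2) 2)) (t-double (suc h))
  w₄ : w 4 ≡ t (2 + h)
  w₄ = trans (cong t (+-comm (h * 2) 4)) (t-double (suc (suc h)))

lowBit-determined : ∀ i j L → 5 ≤ L → factor i L ≡ factor j L → lowBit i ≡ lowBit j
lowBit-determined i j L 5≤L eq with lowBit i | binary-split i | lowBit j | binary-split j
... | false | _  | false | _  = refl
... | true  | _  | true  | _  = refl
... | false | i≡ | true  | j≡ = ⊥-elim (even-odd-disjoint ⌊ i /2⌋ ⌊ j /2⌋ L 5≤L (subst₂ (λ a b → factor a L ≡ factor b L) i≡ j≡ eq))
... | true  | i≡ | false | j≡ = ⊥-elim (even-odd-disjoint ⌊ j /2⌋ ⌊ i /2⌋ L 5≤L (subst₂ (λ a b → factor a L ≡ factor b L) j≡ i≡ (sym eq)))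

t-double-offset : ∀ i s → t (i + s * 2) ≡ lowBit i xor t (⌊ i /2⌋ + s)
t-double-offset i s = trans (cong t (trans (cong (_+ s * 2) (binary-split i)) (regroup (bitValue (lowBit i)) ⌊ i /2⌋ s)))
                            (t-digit (lowBit i) (⌊ i /2⌋ + s))
  where
  regroup : ∀ b h s → b + h * 2 + s * 2 ≡ b + (h + s) * 2
  regroup = solve-∀

xor-cancelˡ : ∀ b c → b xor (b xor c) ≡ c
xor-cancelˡ b c = trans (sym (xor-assoc b b c)) (cong (_xor c) (xor-same b))

factor-halve : ∀ i j L → lowBit i ≡ lowBit j → factor i L ≡ factor j L →
               factor ⌊ i /2⌋ ⌊ L /2⌋ ≡ factor ⌊ j /2⌋ ⌊ L /2⌋
factor-halve i j L same-bit eq = factor-ext ⌊ i /2⌋ ⌊ j /2⌋ ⌊ L /2⌋ λ s s<L/2 → begin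
    t (⌊ i /2⌋ + s)                          ≡⟨ xor-cancelˡ (lowBit i) _ ⟨
    lowBit i xor (lowBit i xor t (⌊ i /2⌋ + s)) ≡⟨ cong (lowBit i xor_) (t-double-offset i s) ⟨
    lowBit i xor t (i + s * 2)               ≡⟨ cong₂ _xor_ same-bit (factor-letter i j L (s * 2) eq (double< s s<L/2)) ⟩
    lowBit j xor t (j + s * 2)               ≡⟨ cong (lowBit j xor_) (t-double-offset j s) ⟩
    lowBit j xor (lowBit j xor t (⌊ j /2⌋ + s)) ≡⟨ xor-cancelˡ (lowBit j) _ ⟩
    t (⌊ j /2⌋ + s)                          ∎
  where
  open ≡-Reasoning
  double< : ∀ s → s < ⌊ L /2⌋ → s * 2 < L
  double< s s<L/2 = ≤-trans (≤-trans (n≤1+n (suc (s * 2))) (*-monoˡ-≤ 2 s<L/2))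
                            (≤-trans (m≤n+m (⌊ L /2⌋ * 2) (bitValue (lowBit L))) (≤-reflexive (sym (binary-split L))))

SameResidue : ℕ → ℕ → ℕ → Set
SameResidue B i j = Σ ℕ λ q → Σ ℕ λ q′ → Σ ℕ λ r → r < B × i ≡ B * q + r × j ≡ B * q′ + r

length-bound-halve : ∀ k L → 6 * 2 ^ suc k ≤ L + 6 → 6 * 2 ^ k ≤ ⌊ L /2⌋ + 6
length-bound-halve k L bound = *-cancelʳ-≤ (6 * 2 ^ k) (⌊ L /2⌋ + 6) 2 (begin
    6 * 2 ^ k * 2                          ≡⟨ regroup (2 ^ k) ⟩
    6 * 2 ^ suc k                          ≤⟨ bound ⟩
    L + 6                                  ≡⟨ cong (_+ 6) (binary-split L) ⟩
    bitValue (lowBit L) + ⌊ L /2⌋ * 2 + 6  ≤⟨ +-monoˡ-≤ 6 (+-monoˡ-≤ (⌊ L /2⌋ * 2) (bitValue≤1 (lowBit L))) ⟩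
    1 + ⌊ L /2⌋ * 2 + 6                    ≤⟨ m≤m+n _ 5 ⟩
    1 + ⌊ L /2⌋ * 2 + 6 + 5                ≡⟨ regroup′ ⌊ L /2⌋ ⟩
    (⌊ L /2⌋ + 6) * 2                      ∎)
  where
  open ≤-Reasoning
  regroup : ∀ P → 6 * P * 2 ≡ 6 * (2 * P)
  regroup = solve-∀
  regroup′ : ∀ h → 1 + h * 2 + 6 + 5 ≡ (h + 6) * 2
  regroup′ = solve-∀

length-bound⇒5≤L : ∀ k L → 6 * 2 ^ suc k ≤ L + 6 → 5 ≤ L
length-bound⇒5≤L k L bound = ≤-trans (n≤1+n 5) (+-cancelʳ-≤ 6 6 L (≤-trans (*-monoʳ-≤ 6 (*-monoʳ-≤ 2 (m^n>0 2 k))) bound))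

sameResidue-double : ∀ k i j → lowBit i ≡ lowBit j → SameResidue (2 ^ k) ⌊ i /2⌋ ⌊ j /2⌋ → SameResidue (2 ^ suc k) i j
sameResidue-double k i j same-bit (q , q′ , r , r<2^k , i/2≡ , j/2≡) =
  q , q′ , b + r * 2 , remainder< , lift i q refl i/2≡ , lift j q′ (cong bitValue same-bit) j/2≡
  where
  b : ℕ
  b = bitValue (lowBit i)
  remainder< : b + r * 2 < 2 ^ suc k
  remainder< = ≤-trans (s≤s (+-monoˡ-≤ (r * 2) (bitValue≤1 (lowBit i))))
                       (≤-trans (*-monoˡ-≤ 2 r<2^k) (≤-reflexive (*-comm (2 ^ k) 2)))
  regroup : ∀ P q b r → b + (P * q + r) * 2 ≡ 2 * P * q + (b + r * 2)
  regroup = solve-∀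
  lift : ∀ x p → b ≡ bitValue (lowBit x) → ⌊ x /2⌋ ≡ 2 ^ k * p + r → x ≡ 2 ^ suc k * p + (b + r * 2)
  lift x p b≡ x/2≡ = trans (binary-split x)
    (trans (cong₂ (λ c z → c + z * 2) (sym b≡) x/2≡) (regroup (2 ^ k) p b r))

-- Induction on k: the occurrences have the same
-- parity, and their halves are equal factors of half the length.
synchronize : ∀ k i j L → 6 * 2 ^ k ≤ L + 6 → factor i L ≡ factor j L → SameResidue (2 ^ k) i j
synchronize zero    i j L _     _  = i , j , 0 , s≤s z≤n ,
  sym (trans (+-identityʳ _) (*-identityˡ i)) , sym (trans (+-identityʳ _) (*-identityˡ j))
synchronize (suc k) i j L bound eq = sameResidue-double k i j same-bit
  (synchronize k ⌊ i /2⌋ ⌊ j /2⌋ ⌊ L /2⌋ (length-bound-halve k L bound) (factor-halve i j L same-bit eq))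
  where
  same-bit : lowBit i ≡ lowBit j
  same-bit = lowBit-determined i j L (length-bound⇒5≤L k L bound) eq

xor-cancelʳ : ∀ a b c → a xor c ≡ b xor c → a ≡ b
xor-cancelʳ a b c eq = begin
  a                ≡⟨ xor-identityʳ a ⟨
  a xor false      ≡⟨ cong (a xor_) (xor-same c) ⟨
  a xor (c xor c)  ≡⟨ xor-assoc a c c ⟨
  (a xor c) xor c  ≡⟨ cong (_xor c) eq ⟩
  (b xor c) xor c  ≡⟨ xor-assoc b c c ⟩
  b xor (c xor c)  ≡⟨ cong (b xor_) (xor-same c) ⟩
  b xor false      ≡⟨ xor-identityʳ b ⟩
  b                ∎
  where open ≡-Reasoning

t-block-offset : ∀ k q r s c ρ → r + s ≡ 2 ^ k * c + ρ → ρ < 2 ^ k → t (2 ^ k * q + r + s) ≡ t (q + c) xor t ρ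
t-block-offset k q r s c ρ r+s≡ ρ<2^k = trans (cong t position) (t-block k (q + c) ρ ρ<2^k)
  where
  position : 2 ^ k * q + r + s ≡ 2 ^ k * (q + c) + ρ
  position = trans (+-assoc (2 ^ k * q) r s) (trans (cong (2 ^ k * q +_) r+s≡)
                   (trans (sym (+-assoc (2 ^ k * q) _ ρ)) (cong (_+ ρ) (sym (*-distribˡ-+ (2 ^ k) q c)))))

divide : ∀ B .{{_ : NonZero B}} x → x ≡ B * (x / B) + x % B
divide B x = trans (m≡m%n+[m/n]*n x B) (trans (+-comm (x % B) _) (cong (_+ x % B) (*-comm (x / B) B)))

quotient< : ∀ B .{{_ : NonZero B}} x C → x < B * C → x / B < C
quotient< B x C x< = *-cancelˡ-< B (x / B) C (begin-strict
    B * (x / B)  ≡⟨ *-comm B (x / B) ⟩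
    x / B * B    ≤⟨ m/n*n≤m x B ⟩
    x            <⟨ x< ⟩
    B * C        ∎)
  where open ≤-Reasoning

-- Letters of the factor at 2^k q + r are read off from letters of t after q,
-- so equal factors at q and q′ covering the blocks transport to equal factors.
factor-transport : ∀ k q q′ r L C → r + L ≤ 2 ^ k * C → factor q C ≡ factor q′ C →
                   factor (2 ^ k * q + r) L ≡ factor (2 ^ k * q′ + r) L
factor-transport k q q′ r L C covered eq = factor-ext _ _ L letters
  where
  letters : ∀ s → s < L → t (2 ^ k * q + r + s) ≡ t (2 ^ k * q′ + r + s)
  letters s s<L = begin
      t (2 ^ k * q + r + s)   ≡⟨ t-block-offset k q r s c ρ (divide (2 ^ k) (r + s)) (m%n<n _ (2 ^ k)) ⟩
      t (q + c) xor t ρ       ≡⟨ cong (_xor t ρ) (factor-letter q q′ C c eq c<C) ⟩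
      t (q′ + c) xor t ρ      ≡⟨ t-block-offset k q′ r s c ρ (divide (2 ^ k) (r + s)) (m%n<n _ (2 ^ k)) ⟨
      t (2 ^ k * q′ + r + s)  ∎
    where
    open ≡-Reasoning
    instance
      2^k≢0 : NonZero (2 ^ k)
      2^k≢0 = m^n≢0 2 k
    c : ℕ
    c = (r + s) / 2 ^ k
    ρ : ℕ
    ρ = (r + s) % 2 ^ k
    c<C : c < C
    c<C = quotient< (2 ^ k) (r + s) C (≤-trans (+-monoʳ-< r s<L) covered)

block-letter : ∀ k q q′ r L s c ρ → factor (2 ^ k * q + r) L ≡ factor (2 ^ k * q′ + r) L →
               s < L → r + s ≡ 2 ^ k * c + ρ → ρ < 2 ^ k → t (q + c) ≡ t (q′ + c)
block-letter k q q′ r L s c ρ eq s<L r+s≡ ρ<2^k = xor-cancelʳ _ _ (t ρ) (begin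
    t (q + c) xor t ρ        ≡⟨ t-block-offset k q r s c ρ r+s≡ ρ<2^k ⟨
    t (2 ^ k * q + r + s)    ≡⟨ factor-letter _ _ L s eq s<L ⟩
    t (2 ^ k * q′ + r + s)   ≡⟨ t-block-offset k q′ r s c ρ r+s≡ ρ<2^k ⟩
    t (q′ + c) xor t ρ       ∎)
  where open ≡-Reasoning

factor-untransport : ∀ k q q′ r L C′ → 0 < L → r < 2 ^ k → 2 ^ k * C′ < r + L →
                     factor (2 ^ k * q + r) L ≡ factor (2 ^ k * q′ + r) L → factor q (suc C′) ≡ factor q′ (suc C′)
factor-untransport k q q′ r L C′ 0<L r<2^k reaches eq = factor-ext q q′ (suc C′) letters
  where
  letters : ∀ c → c < suc C′ → t (q + c) ≡ t (q′ + c)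
  letters zero    _           = block-letter k q q′ r L 0 0 r eq 0<L
    (trans (+-identityʳ r) (sym (cong (_+ r) (*-zeroʳ (2 ^ k))))) r<2^k
  letters (suc c) (s≤s c≤C′) = block-letter k q q′ r L (2 ^ k * suc c ∸ r) (suc c) 0 eq s<L
    (trans (m+[n∸m]≡n r≤) (sym (+-identityʳ _))) (m^n>0 2 k)
    where
    r≤ : r ≤ 2 ^ k * suc c
    r≤ = ≤-trans (<⇒≤ r<2^k) (≤-trans (m≤m+n (2 ^ k) (2 ^ k * c)) (≤-reflexive (sym (*-suc (2 ^ k) c))))
    s<L : 2 ^ k * suc c ∸ r < L
    s<L = +-cancelˡ-< r _ _ (subst (_< r + L) (sym (m+[n∸m]≡n r≤)) (≤-trans (s≤s (*-monoʳ-≤ (2 ^ k) c≤C′)) reaches))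

-- Every factor of length c ≤ 16 already occurs at a
-- position below 96: write q = 16a + b; the factor lies in the blocks a, a+1 of
-- length 16, so it is determined by b and the pair t(a) t(a+1), which occurs at
-- a′ ∈ {0, 1, 2, 5}.

pair-occurs-early : ∀ x y → Σ ℕ λ a′ → a′ ≤ 5 × x ∷ y ∷ [] ≡ factor a′ 2
pair-occurs-early false true  = 0 , z≤n , refl
pair-occurs-early true  true  = 1 , s≤s z≤n , refl
pair-occurs-early true  false = 2 , s≤s (s≤s z≤n) , refl
pair-occurs-early false false = 5 , ≤-refl , refl

early-position : ∀ a b → a ≤ 5 → b < 16 → 16 * a + b < 96
early-position a b a≤5 b<16 = begin-strict
    16 * a + b   <⟨ +-monoʳ-< (16 * a) b<16 ⟩
    16 * a + 16  ≤⟨ +-monoˡ-≤ 16 (*-monoʳ-≤ 16 a≤5) ⟩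
    96           ∎
  where open ≤-Reasoning

early-occurrence : ∀ c q → c ≤ 16 → Σ ℕ λ p → p < 96 × factor q c ≡ factor p c
early-occurrence c q c≤16 with pair-occurs-early (t (q / 16)) (t (suc (q / 16)))
... | a′ , a′≤5 , pair≡ = 16 * a′ + b , early , trans (cong (λ z → factor z c) (divide 16 q))
                                          (factor-transport 4 (q / 16) a′ b c 2 covered pair≡)
  where
  b : ℕ
  b = q % 16
  covered : b + c ≤ 16 * 2
  covered = +-mono-≤ (<⇒≤ (m%n<n q 16)) c≤16
  early : 16 * a′ + b < 96
  early = early-position a′ b a′≤5 (m%n<n q 16)

CoversEarly : ℕ → List ℕ → Set
CoversEarly c Q = All (λ p → Any (λ q′ → factor p c ≡ factor q′ c) Q) (upTo 96)

coversEarly? : ∀ c Q → Dec (CoversEarly c Q)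
coversEarly? c Q = All.all? (λ p → Any.any? (λ q′ → ≡-dec _≟ᵇ_ (factor p c) (factor q′ c)) Q) (upTo 96)

represents : ∀ c Q → c ≤ 16 → CoversEarly c Q → ∀ q → Any (λ q′ → factor q c ≡ factor q′ c) Q
represents c Q c≤16 cover q = Any.map (trans q≈p) p-covered
  where
  early : Σ ℕ λ p → p < 96 × factor q c ≡ factor p c
  early = early-occurrence c q c≤16
  p : ℕ
  p = proj₁ early
  q≈p : factor q c ≡ factor p c
  q≈p = proj₂ (proj₂ early)
  p∈ : p ∈ upTo 96
  p∈ = ∈-upTo⁺ (proj₁ (proj₂ early))
  p-covered : Any (λ q′ → factor p c ≡ factor q′ c) Q
  p-covered = All.lookup cover p∈

Distinct : ℕ → List ℕ → Set
Distinct c Q = AllPairs (λ a b → factor a c ≢ factor b c) Q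

distinct? : ∀ c Q → Dec (Distinct c Q)
distinct? c Q = AllPairs.allPairs? (λ a b → ¬? (≡-dec _≟ᵇ_ (factor a c) (factor b c))) Q

record Representatives (c : ℕ) : Set where
  field
    positions : List ℕ
    complete  : ∀ q → Any (λ q′ → factor q c ≡ factor q′ c) positions
    distinct  : Distinct c positions

certified : ∀ c (Q : List ℕ) → c ≤ 16 → {True (coversEarly? c Q)} → {True (distinct? c Q)} → Representatives c
certified c Q c≤16 {covers} {distinct} = record
  { positions = Q
  ; complete  = represents c Q c≤16 (toWitness covers)
  ; distinct  = toWitness distinct
  }

sumBelow : (ℕ → ℕ) → ℕ → ℕ
sumBelow f zero    = 0
sumBelow f (suc n) = f n + sumBelow f n

pred-positive : ∀ n → 0 < n → n ≡ suc (pred n)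
pred-positive (suc n) _ = refl

sumBelow-cong : ∀ {f g} n → (∀ x → x < n → f x ≡ g x) → sumBelow f n ≡ sumBelow g n
sumBelow-cong zero    _   = refl
sumBelow-cong (suc n) f≗g = cong₂ _+_ (f≗g n ≤-refl) (sumBelow-cong n (λ x x<n → f≗g x (m≤n⇒m≤1+n x<n)))

sumBelow-+ : ∀ f g n → sumBelow (λ x → f x + g x) n ≡ sumBelow f n + sumBelow g n
sumBelow-+ f g zero    = refl
sumBelow-+ f g (suc n) = trans (cong (f n + g n +_) (sumBelow-+ f g n)) (regroup (f n) (g n) (sumBelow f n) (sumBelow g n))
  where
  regroup : ∀ a b c d → a + b + (c + d) ≡ a + c + (b + d)
  regroup = solve-∀

sumBelow-const : ∀ c n → sumBelow (λ _ → c) n ≡ n * c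
sumBelow-const c zero    = refl
sumBelow-const c (suc n) = cong (c +_) (sumBelow-const c n)

sumBelow-scale : ∀ a f n → sumBelow (λ x → a * f x) n ≡ a * sumBelow f n
sumBelow-scale a f zero    = sym (*-zeroʳ a)
sumBelow-scale a f (suc n) = trans (cong (a * f n +_) (sumBelow-scale a f n)) (sym (*-distribˡ-+ a (f n) (sumBelow f n)))

sumBelow-first : ∀ f n → sumBelow f (suc n) ≡ f 0 + sumBelow (f ∘ suc) n
sumBelow-first f zero    = refl
sumBelow-first f (suc n) = trans (cong (f (suc n) +_) (sumBelow-first f n)) (regroup (f (suc n)) (f 0) _)
  where
  regroup : ∀ a b c → a + (b + c) ≡ b + (a + c)
  regroup = solve-∀

sumBelow-pairs : ∀ f n → sumBelow f (n * 2) ≡ sumBelow (λ x → f (x * 2) + f (1 + x * 2)) n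
sumBelow-pairs f zero    = refl
sumBelow-pairs f (suc n) = trans (regroup (f (1 + n * 2)) (f (n * 2)) _) (cong (f (n * 2) + f (1 + n * 2) +_) (sumBelow-pairs f n))
  where
  regroup : ∀ a b c → a + (b + c) ≡ b + a + c
  regroup = solve-∀

filterᵇ-cong : ∀ {f g : ℕ → Bool} xs → (∀ x → f x ≡ g x) → filterᵇ f xs ≡ filterᵇ g xs
filterᵇ-cong {f} {g} xs f≗g = filter-≐ (T? ∘ f) (T? ∘ g) ((λ {x} → subst T (f≗g x)) , (λ {x} → subst T (sym (f≗g x)))) xs

length-filterᵇ-false : ∀ {A : Set} (xs : List A) → length (filterᵇ (λ _ → false) xs) ≡ 0
length-filterᵇ-false []       = refl
length-filterᵇ-false (_ ∷ xs) = length-filterᵇ-false xs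

-- Fix a scale B = 2^k with 6B ≤ 2m + 6.  By synchronization every
-- factor of length 2m has a well defined residue r < B of its positions, and by
-- transport the factor at B q + r is determined by the factor of length
-- window r + 1 at q.  So, given for each residue a duplicate-free list of
-- positions representing all such factors, the abelian-square factors of
-- length 2m are counted by testing finitely many positions per residue.

record BlockCover (k m : ℕ) : Set where
  field
    window          : ℕ → ℕ
    0<m             : 0 < m
    synchronizing   : 6 * 2 ^ k ≤ 2 * m + 6
    reaches         : ∀ r → r < 2 ^ k → 2 ^ k * window r < r + 2 * m
    within          : ∀ r → r < 2 ^ k → r + 2 * m ≤ 2 ^ k * suc (window r)
    representatives : ∀ r → Representatives (suc (window r))

residue : ∀ B .{{_ : NonZero B}} q r → r < B → (B * q + r) % B ≡ r
residue B q r r<B = trans (cong (_% B) (trans (+-comm (B * q) r) (cong (r +_) (*-comm B q))))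
                          (trans ([m+kn]%n≡m%n r q B) (m<n⇒m%n≡m r<B))

sameResidue-unique : ∀ B .{{_ : NonZero B}} q q′ r r′ → r < B → r′ < B →
                     SameResidue B (B * q + r) (B * q′ + r′) → r ≡ r′
sameResidue-unique B q q′ r r′ r<B r′<B (a , a′ , ρ , ρ<B , eq , eq′) = begin
  r                     ≡⟨ residue B q r r<B ⟨
  (B * q + r) % B       ≡⟨ cong (_% B) eq ⟩
  (B * a + ρ) % B       ≡⟨ residue B a ρ ρ<B ⟩
  ρ                     ≡⟨ residue B a′ ρ ρ<B ⟨
  (B * a′ + ρ) % B      ≡⟨ cong (_% B) eq′ ⟨
  (B * q′ + r′) % B     ≡⟨ residue B q′ r′ r′<B ⟩
  r′                    ∎
  where open ≡-Reasoning

module Counting {k m : ℕ} (cover : BlockCover k m) where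
  open BlockCover cover

  reps : ℕ → List ℕ
  reps r = Representatives.positions (representatives r)

  B : ℕ
  B = 2 ^ k

  instance
    B≢0 : NonZero B
    B≢0 = m^n≢0 2 k

  squareReps : ℕ → List ℕ
  squareReps r = filterᵇ (λ q → abSqAt m (B * q + r)) (reps r)

  count : ℕ
  count = sumBelow (λ r → length (squareReps r)) B

  squaresAt : ℕ → List (List Bool)
  squaresAt r = map (λ q → factor (B * q + r) (2 * m)) (squareReps r)

  squaresBelow : ℕ → List (List Bool)
  squaresBelow zero    = []
  squaresBelow (suc n) = squaresAt n ++ squaresBelow n

  length-squaresBelow : ∀ n → length (squaresBelow n) ≡ sumBelow (λ r → length (squareReps r)) n
  length-squaresBelow zero    = refl
  length-squaresBelow (suc n) = trans (length-++ (squaresAt n)) (cong₂ _+_ (length-map _ (squareReps n)) (length-squaresBelow n))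

  ∈-squaresBelow⁻ : ∀ n w → w ∈ squaresBelow n →
                    Σ ℕ λ r → Σ ℕ λ q → r < n × q ∈ squareReps r × w ≡ factor (B * q + r) (2 * m)
  ∈-squaresBelow⁻ (suc n) w w∈ with ∈-++⁻ (squaresAt n) w∈
  ... | inj₁ w∈n with ∈-map⁻ (λ q → factor (B * q + n) (2 * m)) w∈n
  ...   | q , q∈ , w≡ = n , q , ≤-refl , q∈ , w≡
  ∈-squaresBelow⁻ (suc n) w w∈ | inj₂ w∈<n with ∈-squaresBelow⁻ n w w∈<n
  ...   | r , q , r<n , q∈ , w≡ = r , q , m≤n⇒m≤1+n r<n , q∈ , w≡

  ∈-squaresBelow⁺ : ∀ n r q → r < n → q ∈ squareReps r → factor (B * q + r) (2 * m) ∈ squaresBelow n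
  ∈-squaresBelow⁺ (suc n) r q r<n q∈ with m≤n⇒m<n∨m≡n r<n
  ... | inj₁ r<n′ = ∈-++⁺ʳ (squaresAt n) (∈-squaresBelow⁺ n r q (≤-pred r<n′) q∈)
  ... | inj₂ refl = ∈-++⁺ˡ (∈-map⁺ (λ q → factor (B * q + r) (2 * m)) q∈)

  same-residue : ∀ q q′ r r′ → r < B → r′ < B →
                 factor (B * q + r) (2 * m) ≡ factor (B * q′ + r′) (2 * m) → r ≡ r′
  same-residue q q′ r r′ r<B r′<B eq =
    sameResidue-unique B q q′ r r′ r<B r′<B (synchronize k _ _ (2 * m) synchronizing eq)

  -- Within one residue the words are distinct, because distinct representatives
  -- have distinct windows and the window is recovered from the factor.
  unique-squaresAt : ∀ r → r < B → Unique (squaresAt r)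
  unique-squaresAt r r<B = AllPairs.map⁺ (AllPairs.map different
    (AllPairs.filter⁺ (T? ∘ (λ q → abSqAt m (B * q + r))) (Representatives.distinct (representatives r))))
    where
    0<2m : 0 < 2 * m
    0<2m = ≤-trans 0<m (m≤m+n m (m + 0))
    different : ∀ {a b} → factor a (suc (window r)) ≢ factor b (suc (window r)) →
                factor (B * a + r) (2 * m) ≢ factor (B * b + r) (2 * m)
    different {a} {b} windows≢ eq = windows≢ (factor-untransport k a b r (2 * m) (window r) 0<2m r<B (reaches r r<B) eq)

  -- Words with different residues are distinct by synchronization.
  unique-squaresBelow : ∀ n → n ≤ B → Unique (squaresBelow n)
  unique-squaresBelow zero    _   = AllPairs.[]
  unique-squaresBelow (suc n) n<B = AllPairs.++⁺ (unique-squaresAt n n<B) (unique-squaresBelow n (<⇒≤ n<B))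
    (All.tabulate λ {x} x∈ → All.tabulate λ {y} y∈ → apart x y x∈ y∈)
    where
    apart : ∀ x y → x ∈ squaresAt n → y ∈ squaresBelow n → x ≢ y
    apart x y x∈ y∈ x≡y with ∈-map⁻ (λ q → factor (B * q + n) (2 * m)) x∈ | ∈-squaresBelow⁻ n y y∈
    ... | q , _ , x≡ | r′ , q′ , r′<n , _ , y≡ =
      <-irrefl (sym (same-residue q q′ n r′ n<B (<-trans r′<n n<B) (trans (sym x≡) (trans x≡y y≡)))) r′<n

  -- The listed words are exactly the abelian-square factors of length 2m: each
  -- such factor at i = B q + r is transported to the representative of its window.
  count-abelian-squares : CountAbSqFactors m count
  count-abelian-squares = squaresBelow B , unique-squaresBelow B ≤-refl , length-squaresBelow B ,
                          λ w → mk⇔ (sound w) (complete w)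
    where
    sound : ∀ w → w ∈ squaresBelow B → length w ≡ 2 * m × IsFactor w × IsAbelianSquare w
    sound w w∈ with ∈-squaresBelow⁻ B w w∈
    ... | r , q , _ , q∈ , refl = length-factor _ (2 * m) ,
          (B * q + r , trans (factorAt≡factor _ _) (cong (factor (B * q + r)) (length-factor _ (2 * m)))) ,
          abSqAt-sound m (B * q + r) 0<m (proj₂ (∈-filter⁻ (T? ∘ (λ q → abSqAt m (B * q + r))) {xs = reps r} q∈))
    complete : ∀ w → length w ≡ 2 * m × IsFactor w × IsAbelianSquare w → w ∈ squaresBelow B
    complete w (|w| , (i , at-i) , square) = subst (_∈ squaresBelow B) (sym w≡) (∈-squaresBelow⁺ B r q′ r<B q′∈)
      where
      q : ℕ
      q = i / B
      r : ℕ
      r = i % B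
      r<B : r < B
      r<B = m%n<n i B
      w≡factor-i : w ≡ factor i (2 * m)
      w≡factor-i = trans (sym at-i) (trans (factorAt≡factor i (length w)) (cong (factor i) |w|))
      representative : Σ ℕ λ q′ → q′ ∈ reps r × factor q (suc (window r)) ≡ factor q′ (suc (window r))
      representative = find (Representatives.complete (representatives r) q)
      q′ : ℕ
      q′ = proj₁ representative
      shifted : factor (B * q + r) (2 * m) ≡ factor (B * q′ + r) (2 * m)
      shifted = factor-transport k q q′ r (2 * m) (suc (window r)) (within r r<B) (proj₂ (proj₂ representative))
      i≡ : i ≡ B * q + r
      i≡ = divide B i
      w≡ : w ≡ factor (B * q′ + r) (2 * m)
      w≡ = trans w≡factor-i (trans (cong (λ z → factor z (2 * m)) i≡) shifted)
      passes : T (abSqAt m (B * q′ + r))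
      passes = subst T (trans (cong (abSqAt m) i≡) (abSqAt-factor m _ _ shifted))
                       (abSqAt-complete m i (subst IsAbelianSquare w≡factor-i square))
      q′∈ : q′ ∈ squareReps r
      q′∈ = ∈-filter⁺ (T? ∘ (λ q → abSqAt m (B * q + r))) (proj₁ (proj₂ representative)) passes

-- Certified representatives for the window lengths used below; the list for
-- length c has one position per factor, i.e. p(c) = 16, 20, 22, 24 entries.

reps6 : Representatives 6
reps6 = certified 6 (0 ∷ 1 ∷ 2 ∷ 3 ∷ 4 ∷ 5 ∷ 6 ∷ 7 ∷ 8 ∷ 9 ∷ 10 ∷ 11 ∷ 15 ∷ 19 ∷ 21 ∷ 23 ∷ []) (≤ᵇ⇒≤ 6 16 _)

reps7 : Representatives 7
reps7 = certified 7 (0 ∷ 1 ∷ 2 ∷ 3 ∷ 4 ∷ 5 ∷ 6 ∷ 7 ∷ 8 ∷ 9 ∷ 10 ∷ 11 ∷ 14 ∷ 15 ∷ 18 ∷ 19 ∷ 20 ∷ 21 ∷ 22 ∷ 23 ∷ []) (≤ᵇ⇒≤ 7 16 _)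

reps8 : Representatives 8
reps8 = certified 8 (0 ∷ 1 ∷ 2 ∷ 3 ∷ 4 ∷ 5 ∷ 6 ∷ 7 ∷ 8 ∷ 9 ∷ 10 ∷ 11 ∷ 13 ∷ 14 ∷ 15 ∷ 17 ∷ 18 ∷ 19 ∷ 20 ∷ 21 ∷ 22 ∷ 23 ∷ []) (≤ᵇ⇒≤ 8 16 _)

reps9 : Representatives 9
reps9 = certified 9 (upTo 24) (≤ᵇ⇒≤ 9 16 _)

-- At scale B = 2^(n′+1) we have 2m = 6B, so the
-- windows have length 6 (residue 0) or 7.  At even positions every factor of
-- even length is an abelian square; at odd positions 2y + 1 the test asks for
-- t(y) = t(y + 3P) = t(y + 6P), P = 2^n′, i.e. for t(q) = t(q+3) = t(q+6).
module ThreeTimesPowerOfTwo (n′ : ℕ) where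

  P : ℕ
  P = 2 ^ n′

  B : ℕ
  B = 2 ^ suc n′

  m : ℕ
  m = 3 * B

  0<B : 0 < B
  0<B = m^n>0 2 (suc n′)

  2m≡6B : 2 * m ≡ B * 6
  2m≡6B = arith B
    where
    arith : ∀ B → 2 * (3 * B) ≡ B * 6
    arith = solve-∀

  -- Residue 0 spans exactly six blocks, any other residue reaches into a seventh.
  window : ℕ → ℕ
  window zero    = 5
  window (suc _) = 6

  reaches : ∀ r → r < B → B * window r < r + 2 * m
  reaches zero    _ = subst (B * 5 <_) (sym (trans 2m≡6B (arith B))) (m<m+n (B * 5) 0<B)
    where
    arith : ∀ B → B * 6 ≡ B * 5 + B
    arith = solve-∀
  reaches (suc r) _ = subst (B * 6 <_) (cong (suc r +_) (sym 2m≡6B)) (m<n+m (B * 6) (s≤s z≤n))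

  within : ∀ r → r < B → r + 2 * m ≤ B * suc (window r)
  within zero    _   = ≤-reflexive 2m≡6B
  within (suc r) r<B = subst (suc r + 2 * m ≤_) (sym (arith B))
                             (subst (λ z → suc r + z ≤ B + B * 6) (sym 2m≡6B) (+-monoˡ-≤ (B * 6) (<⇒≤ r<B)))
    where
    arith : ∀ B → B * 7 ≡ B + B * 6
    arith = solve-∀

  representatives : ∀ r → Representatives (suc (window r))
  representatives zero    = reps6
  representatives (suc _) = reps7

  cover : BlockCover (suc n′) m
  cover = record
    { window          = window
    ; 0<m             = ≤-trans 0<B (m≤m+n B _)
    ; synchronizing   = ≤-trans (≤-reflexive (trans (*-comm 6 B) (sym 2m≡6B))) (m≤m+n (2 * m) 6)
    ; reaches         = reaches
    ; within          = within
    ; representatives = representatives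
    }

  open Counting cover using (reps; squareReps; count; count-abelian-squares)

  m≡ : m ≡ (3 * P) * 2
  m≡ = arith P
    where
    arith : ∀ P → 3 * (2 * P) ≡ (3 * P) * 2
    arith = solve-∀

  square-even : ∀ q N → abSqAt m (B * q + N * 2) ≡ true
  square-even q N = trans (cong₂ abSqAt m≡ (position P q N)) (abSqAt-even-even (3 * P) (P * q + N))
    where
    position : ∀ P q N → 2 * P * q + N * 2 ≡ (P * q + N) * 2
    position = solve-∀

  square-odd : ∀ q N → N < P → abSqAt m (B * q + (1 + N * 2)) ≡ (sameBit (t q) (t (q + 3)) ∧ sameBit (t (q + 3)) (t (q + 6)))
  square-odd q N N<P = begin
      abSqAt m (B * q + (1 + N * 2))
    ≡⟨ cong₂ abSqAt m≡ (position P q N) ⟩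
      abSqAt ((3 * P) * 2) (1 + y * 2)
    ≡⟨ abSqAt-odd-even (3 * P) y ⟩
      (sameBit (t y) (t (y + 3 * P)) ∧ sameBit (t (y + 3 * P)) (t (y + 3 * P + 3 * P)))
    ≡⟨ cong₃ (λ a b c → sameBit a b ∧ sameBit b c) (t-block n′ q N N<P) (block 3 (shift₃ P q N)) (block 6 (shift₆ P q N)) ⟩
      (sameBit (t q xor t N) (t (q + 3) xor t N) ∧ sameBit (t (q + 3) xor t N) (t (q + 6) xor t N))
    ≡⟨ cong₂ _∧_ (sameBit-xor (t q) (t (q + 3)) (t N)) (sameBit-xor (t (q + 3)) (t (q + 6)) (t N)) ⟩
      (sameBit (t q) (t (q + 3)) ∧ sameBit (t (q + 3)) (t (q + 6))) ∎
    where
    open ≡-Reasoning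
    y : ℕ
    y = P * q + N
    position : ∀ P q N → 2 * P * q + (1 + N * 2) ≡ 1 + (P * q + N) * 2
    position = solve-∀
    shift₃ : ∀ P q N → P * q + N + 3 * P ≡ P * (q + 3) + N
    shift₃ = solve-∀
    shift₆ : ∀ P q N → P * q + N + 3 * P + 3 * P ≡ P * (q + 6) + N
    shift₆ = solve-∀
    cong₃ : ∀ (f : Bool → Bool → Bool → Bool) {a a′ b b′ c c′} → a ≡ a′ → b ≡ b′ → c ≡ c′ → f a b c ≡ f a′ b′ c′
    cong₃ f refl refl refl = refl
    block : ∀ d {x} → x ≡ P * (q + d) + N → t x ≡ t (q + d) xor t N
    block d x≡ = trans (cong t x≡) (t-block n′ (q + d) N N<P)

  -- Residues 2N and 2N + 1 together contribute 16 + 8 abelian squares for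
  -- N = 0 and 20 + 8 otherwise.
  pairCount : ℕ → ℕ
  pairCount zero    = 24
  pairCount (suc _) = 28

  count-pair : ∀ N → N < P → length (squareReps (N * 2)) + length (squareReps (1 + N * 2)) ≡ pairCount N
  count-pair zero    N<P = cong₂ _+_ (cong length (filterᵇ-cong (reps 0) (λ q → square-even q 0)))
                                     (cong length (filterᵇ-cong (reps 1) (λ q → square-odd q 0 N<P)))
  count-pair (suc N) N<P = cong₂ _+_ (cong length (filterᵇ-cong (reps (suc N * 2)) (λ q → square-even q (suc N))))
                                     (cong length (filterᵇ-cong (reps (1 + suc N * 2)) (λ q → square-odd q (suc N) N<P)))

  count≡ : count ≡ 14 * B ∸ 4
  count≡ = begin
      sumBelow h B                                           ≡⟨ cong (sumBelow h) (*-comm 2 P) ⟩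
      sumBelow h (P * 2)                                     ≡⟨ sumBelow-pairs h P ⟩
      sumBelow (λ N → h (N * 2) + h (1 + N * 2)) P           ≡⟨ sumBelow-cong P count-pair ⟩
      sumBelow pairCount P                                   ≡⟨ cong (sumBelow pairCount) P≡ ⟩
      sumBelow pairCount (suc P′)                            ≡⟨ sumBelow-first pairCount P′ ⟩
      24 + sumBelow (λ _ → 28) P′                            ≡⟨ cong (24 +_) (sumBelow-const 28 P′) ⟩
      24 + P′ * 28                                           ≡⟨ m+n∸n≡m _ 4 ⟨
      24 + P′ * 28 + 4 ∸ 4                                   ≡⟨ cong (_∸ 4) (arith P′) ⟨
      14 * (2 * suc P′) ∸ 4                                  ≡⟨ cong (λ p → 14 * (2 * p) ∸ 4) P≡ ⟨
      14 * B ∸ 4                                             ∎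
    where
    open ≡-Reasoning
    h : ℕ → ℕ
    h r = length (squareReps r)
    P′ : ℕ
    P′ = pred P
    P≡ : P ≡ suc P′
    P≡ = pred-positive P (m^n>0 2 n′)
    arith : ∀ p → 14 * (2 * suc p) ≡ 24 + p * 28 + 4
    arith = solve-∀

  count-three-times-power : CountAbSqFactors (3 * 2 ^ suc n′) (14 * 2 ^ suc n′ ∸ 4)
  count-three-times-power = subst (CountAbSqFactors m) count≡ count-abelian-squares

-- Changes of letter in t: changes N = 1 iff t(N − 1) ≠ t(N).  In the prefix of
-- length 2^K with K odd there are (2^(K+1) − 1)/3 changes.

changes : ℕ → ℕ
changes zero    = 0
changes (suc N) = bitValue (t (suc N) xor t N)

changesBelow : ℕ → ℕ
changesBelow = sumBelow changes

changes-odd : ∀ N → changes (1 + N * 2) ≡ 1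
changes-odd N = cong bitValue (trans (cong₂ _xor_ (t-double+1 N) (t-double N)) (not-xor-self (t N)))
  where
  not-xor-self : ∀ a → not a xor a ≡ true
  not-xor-self false = refl
  not-xor-self true  = refl

changes-even : ∀ N → changes (suc N * 2) + changes (suc N) ≡ 1
changes-even N = trans (cong (λ z → bitValue z + changes (suc N)) (cong₂ _xor_ (t-double (suc N)) (t-double+1 N)))
                       (complementary (t (suc N)) (t N))
  where
  complementary : ∀ a b → bitValue (a xor not b) + bitValue (a xor b) ≡ 1
  complementary false false = refl
  complementary false true  = refl
  complementary true  false = refl
  complementary true  true  = refl

pairChanges : ℕ → ℕ
pairChanges zero    = 1
pairChanges (suc _) = 2

changes-pair : ∀ N → changes (N * 2) + changes (1 + N * 2) + changes N ≡ pairChanges N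
changes-pair zero    = refl
changes-pair (suc N) = begin
    changes (suc N * 2) + changes (1 + suc N * 2) + changes (suc N)  ≡⟨ cong (λ z → changes (suc N * 2) + z + changes (suc N)) (changes-odd (suc N)) ⟩
    changes (suc N * 2) + 1 + changes (suc N)                        ≡⟨ regroup (changes (suc N * 2)) (changes (suc N)) ⟩
    1 + (changes (suc N * 2) + changes (suc N))                      ≡⟨ cong (1 +_) (changes-even N) ⟩
    2                                                                ∎
  where
  open ≡-Reasoning
  regroup : ∀ a b → a + 1 + b ≡ 1 + (a + b)
  regroup = solve-∀

changesBelow-double : ∀ n → changesBelow (suc n * 2) + changesBelow (suc n) + 1 ≡ suc n * 2
changesBelow-double n = begin
    changesBelow (suc n * 2) + changesBelow (suc n) + 1
  ≡⟨ cong (λ z → z + changesBelow (suc n) + 1) (sumBelow-pairs changes (suc n)) ⟩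
    sumBelow (λ N → changes (N * 2) + changes (1 + N * 2)) (suc n) + changesBelow (suc n) + 1
  ≡⟨ cong (_+ 1) (sumBelow-+ (λ N → changes (N * 2) + changes (1 + N * 2)) changes (suc n)) ⟨
    sumBelow (λ N → changes (N * 2) + changes (1 + N * 2) + changes N) (suc n) + 1
  ≡⟨ cong (_+ 1) (sumBelow-cong (suc n) (λ N _ → changes-pair N)) ⟩
    sumBelow pairChanges (suc n) + 1
  ≡⟨ cong (_+ 1) (sumBelow-first pairChanges n) ⟩
    1 + sumBelow (λ _ → 2) n + 1
  ≡⟨ cong (λ z → 1 + z + 1) (sumBelow-const 2 n) ⟩
    1 + n * 2 + 1
  ≡⟨ regroup n ⟩
    suc n * 2 ∎
  where
  open ≡-Reasoning
  regroup : ∀ n → 1 + n * 2 + 1 ≡ suc n * 2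
  regroup = solve-∀

changesBelow-power : ∀ K → changesBelow (2 ^ suc K) + changesBelow (2 ^ K) + 1 ≡ 2 ^ suc K
changesBelow-power K = trans (cong (λ z → changesBelow z + changesBelow (2 ^ K) + 1) (*-comm 2 (2 ^ K)))
                             (trans (doubled (2 ^ K) (m^n>0 2 K)) (*-comm (2 ^ K) 2))
  where
  doubled : ∀ x → 0 < x → changesBelow (x * 2) + changesBelow x + 1 ≡ x * 2
  doubled (suc n) _ = changesBelow-double n

two-steps : ∀ X e₀ e₁ e₂ → e₁ + e₀ + 1 ≡ 2 * X → e₂ + e₁ + 1 ≡ 2 * (2 * X) → 3 * e₀ + 1 ≡ 2 * X →
            3 * e₂ + 1 ≡ 2 * (2 * (2 * X))
two-steps X e₀ e₁ e₂ step₁ step₂ hyp = +-cancelʳ-≡ (3 * (2 * X)) _ _ (begin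
    3 * e₂ + 1 + 3 * (2 * X)            ≡⟨ cong (λ z → 3 * e₂ + 1 + 3 * z) step₁ ⟨
    3 * e₂ + 1 + 3 * (e₁ + e₀ + 1)      ≡⟨ regroup e₂ e₁ e₀ ⟩
    3 * (e₂ + e₁ + 1) + (3 * e₀ + 1)    ≡⟨ cong₂ (λ a b → 3 * a + b) step₂ hyp ⟩
    3 * (2 * (2 * X)) + 2 * X           ≡⟨ regroup′ X ⟩
    2 * (2 * (2 * X)) + 3 * (2 * X)     ∎)
  where
  open ≡-Reasoning
  regroup : ∀ a b c → 3 * a + 1 + 3 * (b + c + 1) ≡ 3 * (a + b + 1) + (3 * c + 1)
  regroup = solve-∀
  regroup′ : ∀ X → 3 * (2 * (2 * X)) + 2 * X ≡ 2 * (2 * (2 * X)) + 3 * (2 * X)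
  regroup′ = solve-∀

changesBelow-odd-power : ∀ j → 3 * changesBelow (2 ^ suc (j + j)) + 1 ≡ 2 ^ suc (suc (j + j))
changesBelow-odd-power zero    = refl
changesBelow-odd-power (suc j) = subst (λ z → 3 * changesBelow (2 ^ suc z) + 1 ≡ 2 ^ suc (suc z)) (sym (+-suc (suc j) j))
  (two-steps (2 ^ K) (changesBelow (2 ^ K)) (changesBelow (2 ^ suc K)) (changesBelow (2 ^ suc (suc K)))
             (changesBelow-power K) (changesBelow-power (suc K)) (changesBelow-odd-power j))
  where
  K : ℕ
  K = suc (j + j)

-- t(2^K − 1) is the parity of K (the binary expansion of 2^K − 1 has K ones).
t-power-pred : ∀ k → t (pred (2 ^ suc k)) ≡ not (t (pred (2 ^ k)))
t-power-pred k with 2 ^ k | pred-positive (2 ^ k) (m^n>0 2 k)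
... | suc a | _ = trans (cong t (position a)) (t-double+1 a)
  where
  position : ∀ a → pred (2 * suc a) ≡ 1 + a * 2
  position a = cong pred (arith a)
    where
    arith : ∀ a → 2 * suc a ≡ 2 + a * 2
    arith = solve-∀

t-odd-power-pred : ∀ j → t (pred (2 ^ suc (j + j))) ≡ true
t-odd-power-pred zero    = refl
t-odd-power-pred (suc j) = begin
    t (pred (2 ^ suc (suc j + suc j)))     ≡⟨ cong (λ z → t (pred (2 ^ suc z))) (+-suc (suc j) j) ⟩
    t (pred (2 ^ suc (suc (suc (j + j))))) ≡⟨ t-power-pred (suc (suc (j + j))) ⟩
    not (t (pred (2 ^ suc (suc (j + j))))) ≡⟨ cong not (t-power-pred (suc (j + j))) ⟩
    not (not (t (pred (2 ^ suc (j + j))))) ≡⟨ not-involutive _ ⟩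
    t (pred (2 ^ suc (j + j)))             ≡⟨ t-odd-power-pred j ⟩
    true                                   ∎
  where open ≡-Reasoning

4^≡2^ : ∀ j → 4 ^ j ≡ 2 ^ (j + j)
4^≡2^ zero    = refl
4^≡2^ (suc j) = trans (cong (4 *_) (4^≡2^ j)) (trans (arith (2 ^ (j + j))) (cong (λ z → 2 ^ suc z) (sym (+-suc j j))))
  where
  arith : ∀ X → 4 * X ≡ 2 * (2 * X)
  arith = solve-∀

-- Second family: m = 4^n − 1 with n = j + 2.  Put K = 2j + 1, P = 2^K, so
-- m = 8P − 1 = 2M + 1 with M = 4P − 1, and use the scale B = 2P, where
-- 2m = 16P − 2 gives windows of length 8 (residues 0, 1, 2) or 9.
-- Since m is odd, no factor at an even position is an abelian square; at an
-- odd position 2y + 1 the test asks for t(y) ≠ t(y + 2M + 1).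
module FourPowerMinusOne (j : ℕ) where

  K : ℕ
  K = suc (j + j)

  P : ℕ
  P = 2 ^ K

  B : ℕ
  B = 2 ^ suc K

  m : ℕ
  m = 4 ^ suc (suc j) ∸ 1

  p₀ : ℕ
  p₀ = pred (pred P)

  P≡ : P ≡ suc (suc p₀)
  P≡ = at-least-two P (*-monoʳ-≤ 2 (m^n>0 2 (j + j)))
    where
    at-least-two : ∀ x → 2 ≤ x → x ≡ suc (suc (pred (pred x)))
    at-least-two (suc (suc x)) _             = refl
    at-least-two (suc zero)    (s≤s ())

  -- m = 2M + 1 with M = 4P − 1.
  M : ℕ
  M = 4 * p₀ + 7

  4^n≡8P : 4 ^ suc (suc j) ≡ 8 * P
  4^n≡8P = trans (cong (λ z → 4 * (4 * z)) (4^≡2^ j)) (arith (2 ^ (j + j)))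
    where
    arith : ∀ X → 4 * (4 * X) ≡ 8 * (2 * X)
    arith = solve-∀

  m≡ : m ≡ 1 + M * 2
  m≡ = cong (_∸ 1) (trans 4^n≡8P (trans (cong (8 *_) P≡) (arith p₀)))
    where
    arith : ∀ p → 8 * suc (suc p) ≡ suc (1 + (4 * p + 7) * 2)
    arith = solve-∀

  B≡ : B ≡ 2 * p₀ + 4
  B≡ = trans (cong (2 *_) P≡) (arith p₀)
    where
    arith : ∀ p → 2 * suc (suc p) ≡ 2 * p + 4
    arith = solve-∀

  2m≡ : 2 * m ≡ 16 * p₀ + 30
  2m≡ = trans (cong (2 *_) m≡) (arith p₀)
    where
    arith : ∀ p → 2 * (1 + (4 * p + 7) * 2) ≡ 16 * p + 30
    arith = solve-∀

  -- Residues 0, 1, 2 reach into the eighth block, the others into the ninth.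
  window : ℕ → ℕ
  window zero                = 7
  window (suc zero)          = 7
  window (suc (suc zero))    = 7
  window (suc (suc (suc _))) = 8

  ≤-by : ∀ a b c → b ≡ a + c → a ≤ b
  ≤-by a b c b≡ = subst (a ≤_) (sym b≡) (m≤m+n a c)

  reaches′ : ∀ r → (2 * p₀ + 4) * window r < r + (16 * p₀ + 30)
  reaches′ zero                = ≤-by _ _ (2 * p₀ + 1) (arith p₀)
    where
    arith : ∀ p → 16 * p + 30 ≡ suc ((2 * p + 4) * 7) + (2 * p + 1)
    arith = solve-∀
  reaches′ (suc zero)          = ≤-by _ _ (2 * p₀ + 2) (arith p₀)
    where
    arith : ∀ p → 1 + (16 * p + 30) ≡ suc ((2 * p + 4) * 7) + (2 * p + 2)
    arith = solve-∀
  reaches′ (suc (suc zero))    = ≤-by _ _ (2 * p₀ + 3) (arith p₀)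
    where
    arith : ∀ p → 2 + (16 * p + 30) ≡ suc ((2 * p + 4) * 7) + (2 * p + 3)
    arith = solve-∀
  reaches′ (suc (suc (suc r))) = ≤-by _ _ r (arith p₀ r)
    where
    arith : ∀ p r → 3 + r + (16 * p + 30) ≡ suc ((2 * p + 4) * 8) + r
    arith = solve-∀

  within′ : ∀ r → r < 2 * p₀ + 4 → r + (16 * p₀ + 30) ≤ (2 * p₀ + 4) * suc (window r)
  within′ zero                _   = ≤-by _ _ 2 (arith p₀)
    where
    arith : ∀ p → (2 * p + 4) * 8 ≡ 16 * p + 30 + 2
    arith = solve-∀
  within′ (suc zero)          _   = ≤-by _ _ 1 (arith p₀)
    where
    arith : ∀ p → (2 * p + 4) * 8 ≡ 1 + (16 * p + 30) + 1
    arith = solve-∀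
  within′ (suc (suc zero))    _   = ≤-by _ _ 0 (arith p₀)
    where
    arith : ∀ p → (2 * p + 4) * 8 ≡ 2 + (16 * p + 30) + 0
    arith = solve-∀
  within′ (suc (suc (suc r))) r<B = ≤-trans (+-monoˡ-≤ (16 * p₀ + 30) (<⇒≤ r<B)) (≤-by _ _ 2 (arith p₀))
    where
    arith : ∀ p → (2 * p + 4) * 9 ≡ 2 * p + 4 + (16 * p + 30) + 2
    arith = solve-∀

  representatives : ∀ r → Representatives (suc (window r))
  representatives zero                = reps8
  representatives (suc zero)          = reps8
  representatives (suc (suc zero))    = reps8
  representatives (suc (suc (suc _))) = reps9

  cover : BlockCover (suc K) m
  cover = record
    { window          = window
    ; 0<m             = subst (0 <_) (sym m≡) (s≤s z≤n)
    ; synchronizing   = subst₂ (λ b l → 6 * b ≤ l + 6) (sym B≡) (sym 2m≡) (≤-by _ _ (4 * p₀ + 12) (arith p₀))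
    ; reaches         = λ r _ → subst₂ (λ b l → b * window r < r + l) (sym B≡) (sym 2m≡) (reaches′ r)
    ; within          = λ r r<B → subst₂ (λ b l → r + l ≤ b * suc (window r)) (sym B≡) (sym 2m≡) (within′ r (subst (r <_) B≡ r<B))
    ; representatives = representatives
    }
    where
    arith : ∀ p → 16 * p + 30 + 6 ≡ 6 * (2 * p + 4) + (4 * p + 12)
    arith = solve-∀

  open Counting cover using (reps; squareReps; count; count-abelian-squares)

  position : ∀ q N → B * q + (1 + N * 2) ≡ 1 + (P * q + N) * 2
  position q N = arith P q N
    where
    arith : ∀ P q N → 2 * P * q + (1 + N * 2) ≡ 1 + (P * q + N) * 2
    arith = solve-∀

  square-even : ∀ q N → abSqAt m (B * q + N * 2) ≡ false
  square-even q N = trans (cong₂ abSqAt m≡ (arith P q N)) (abSqAt-even-odd M (P * q + N))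
    where
    arith : ∀ P q N → 2 * P * q + N * 2 ≡ (P * q + N) * 2
    arith = solve-∀

  square-odd : ∀ q N → abSqAt m (B * q + (1 + N * 2)) ≡ t (P * q + N) xor t (P * q + N + M + M + 1)
  square-odd q N = trans (cong₂ abSqAt m≡ (position q N)) (abSqAt-odd-odd M (P * q + N))

  -- Residue 1 (N = 0): y + 2M + 1 = P(q + 7) + (P − 1) and t(P − 1) = 1.
  square-residue-1 : ∀ q → abSqAt m (B * q + 1) ≡ (t q xor t 0) xor (t (q + 7) xor true)
  square-residue-1 q = trans (square-odd q 0)
    (cong₂ _xor_ (t-block K q 0 (m^n>0 2 K))
                 (trans (cong t (far-position P p₀ q P≡)) (trans (t-block K (q + 7) (suc p₀) p₀+1<P) (cong (t (q + 7) xor_) t[p₀+1]))))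
    where
    far-position : ∀ P p₀ q → P ≡ suc (suc p₀) → P * q + 0 + (4 * p₀ + 7) + (4 * p₀ + 7) + 1 ≡ P * (q + 7) + suc p₀
    far-position _ p₀ q refl = arith p₀ q
      where
      arith : ∀ p₀ q → suc (suc p₀) * q + 0 + (4 * p₀ + 7) + (4 * p₀ + 7) + 1 ≡ suc (suc p₀) * (q + 7) + suc p₀
      arith = solve-∀
    p₀+1<P : suc p₀ < P
    p₀+1<P = subst (suc p₀ <_) (sym P≡) ≤-refl
    t[p₀+1] : t (suc p₀) ≡ true
    t[p₀+1] = trans (cong (λ z → t (pred z)) (sym P≡)) (t-odd-power-pred j)

  -- Residue 2N + 1 with N = N′ + 1: y + 2M + 1 = P(q + 8) + N′.
  square-residue-odd : ∀ q N′ → suc N′ < P →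
    abSqAt m (B * q + (1 + suc N′ * 2)) ≡ (t q xor t (q + 8)) xor (t (suc N′) xor t N′)
  square-residue-odd q N′ N<P = begin
      abSqAt m (B * q + (1 + suc N′ * 2))
    ≡⟨ square-odd q (suc N′) ⟩
      t (P * q + suc N′) xor t (P * q + suc N′ + M + M + 1)
    ≡⟨ cong₂ _xor_ (t-block K q (suc N′) N<P)
                   (trans (cong t (far-position P p₀ q N′ P≡)) (t-block K (q + 8) N′ (≤-trans (n≤1+n _) N<P))) ⟩
      (t q xor t (suc N′)) xor (t (q + 8) xor t N′)
    ≡⟨ xor-interchange (t q) (t (suc N′)) (t (q + 8)) (t N′) ⟩
      (t q xor t (q + 8)) xor (t (suc N′) xor t N′) ∎
    where
    open ≡-Reasoning
    far-position : ∀ P p₀ q N′ → P ≡ suc (suc p₀) →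
            P * q + suc N′ + (4 * p₀ + 7) + (4 * p₀ + 7) + 1 ≡ P * (q + 8) + N′
    far-position _ p₀ q N′ refl = arith p₀ q N′
      where
      arith : ∀ p₀ q N′ → suc (suc p₀) * q + suc N′ + (4 * p₀ + 7) + (4 * p₀ + 7) + 1 ≡ suc (suc p₀) * (q + 8) + N′
      arith = solve-∀

  -- Residues 2N and 2N + 1, weighted with the letter changes: 0 + 12 for N = 0
  -- and 0 + (16 − 8 changes N) otherwise.
  pairValue : ℕ → ℕ
  pairValue zero    = 12
  pairValue (suc _) = 16

  count-pair : ∀ N → N < P → length (squareReps (N * 2)) + length (squareReps (1 + N * 2)) + 8 * changes N ≡ pairValue N
  count-pair N N<P = trans (cong (λ z → z + length (squareReps (1 + N * 2)) + 8 * changes N)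
                                 (trans (cong length (filterᵇ-cong (reps (N * 2)) (λ q → square-even q N))) (length-filterᵇ-false (reps (N * 2)))))
                           (odd-residue N N<P)
    where
    odd-residue : ∀ N → N < P → length (squareReps (1 + N * 2)) + 8 * changes N ≡ pairValue N
    odd-residue zero     _   = cong (λ z → length z + 0) (filterᵇ-cong (reps 1) square-residue-1)
    odd-residue (suc N′) N<P = trans (cong (λ z → length z + 8 * changes (suc N′))
                                           (filterᵇ-cong (reps (1 + suc N′ * 2)) (λ q → square-residue-odd q N′ N<P)))
                                     (by-change (t (suc N′) xor t N′))
      where
      by-change : ∀ d → length (filterᵇ (λ q → (t q xor t (q + 8)) xor d) (reps 3)) + 8 * bitValue d ≡ 16
      by-change false = refl
      by-change true  = refl

  count+changes : count + 8 * changesBelow P + 4 ≡ 16 * P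
  count+changes = begin
      sumBelow h B + 8 * changesBelow P + 4
    ≡⟨ cong (λ z → sumBelow h z + 8 * changesBelow P + 4) (*-comm 2 P) ⟩
      sumBelow h (P * 2) + 8 * changesBelow P + 4
    ≡⟨ cong₂ (λ a b → a + b + 4) (sumBelow-pairs h P) (sym (sumBelow-scale 8 changes P)) ⟩
      sumBelow (λ N → h (N * 2) + h (1 + N * 2)) P + sumBelow (λ N → 8 * changes N) P + 4
    ≡⟨ cong (_+ 4) (sumBelow-+ (λ N → h (N * 2) + h (1 + N * 2)) (λ N → 8 * changes N) P) ⟨
      sumBelow (λ N → h (N * 2) + h (1 + N * 2) + 8 * changes N) P + 4
    ≡⟨ cong (_+ 4) (sumBelow-cong P count-pair) ⟩
      sumBelow pairValue P + 4
    ≡⟨ cong (λ z → sumBelow pairValue z + 4) P≡ ⟩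
      sumBelow pairValue (suc (suc p₀)) + 4
    ≡⟨ cong (_+ 4) (sumBelow-first pairValue (suc p₀)) ⟩
      12 + sumBelow (λ _ → 16) (suc p₀) + 4
    ≡⟨ cong (λ z → 12 + z + 4) (sumBelow-const 16 (suc p₀)) ⟩
      12 + suc p₀ * 16 + 4
    ≡⟨ arith p₀ ⟩
      16 * suc (suc p₀)
    ≡⟨ cong (16 *_) P≡ ⟨
      16 * P ∎
    where
    open ≡-Reasoning
    h : ℕ → ℕ
    h r = length (squareReps r)
    arith : ∀ p → 12 + suc p * 16 + 4 ≡ 16 * suc (suc p)
    arith = solve-∀

  -- With 3 changesBelow P + 1 = 2P this gives 3 count + 4 = 32 P = 4^(n+1).
  three-count : 3 * count + 4 ≡ 32 * P
  three-count = +-cancelʳ-≡ (16 * P) _ _ (begin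
      3 * count + 4 + 16 * P                           ≡⟨ cong (3 * count + 4 +_) (*-assoc 8 2 P) ⟩
      3 * count + 4 + 8 * (2 * P)                      ≡⟨ cong (λ z → 3 * count + 4 + 8 * z) (changesBelow-odd-power j) ⟨
      3 * count + 4 + 8 * (3 * changesBelow P + 1)     ≡⟨ arith count (changesBelow P) ⟩
      3 * (count + 8 * changesBelow P + 4)             ≡⟨ cong (3 *_) count+changes ⟩
      3 * (16 * P)                                     ≡⟨ arith′ P ⟩
      32 * P + 16 * P                                  ∎)
    where
    open ≡-Reasoning
    arith : ∀ c e → 3 * c + 4 + 8 * (3 * e + 1) ≡ 3 * (c + 8 * e + 4)
    arith = solve-∀
    arith′ : ∀ P → 3 * (16 * P) ≡ 32 * P + 16 * P
    arith′ = solve-∀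

  count≡ : (4 ^ (suc (suc j) + 1) ∸ 4) / 3 ≡ count
  count≡ = begin
      (4 ^ (suc (suc j) + 1) ∸ 4) / 3   ≡⟨ cong (λ z → (z ∸ 4) / 3) 4^[n+1]≡32P ⟩
      (32 * P ∸ 4) / 3                  ≡⟨ cong (λ z → (z ∸ 4) / 3) three-count ⟨
      (3 * count + 4 ∸ 4) / 3           ≡⟨ cong (_/ 3) (trans (m+n∸n≡m (3 * count) 4) (*-comm 3 count)) ⟩
      count * 3 / 3                     ≡⟨ m*n/n≡m count 3 ⟩
      count                             ∎
    where
    open ≡-Reasoning
    4^[n+1]≡32P : 4 ^ (suc (suc j) + 1) ≡ 32 * P
    4^[n+1]≡32P = trans (cong (4 ^_) (+-comm (suc (suc j)) 1)) (trans (cong (4 *_) 4^n≡8P) (arith P))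
      where
      arith : ∀ P → 4 * (8 * P) ≡ 32 * P
      arith = solve-∀

  count-four-power-minus-one : CountAbSqFactors (4 ^ suc (suc j) ∸ 1) ((4 ^ (suc (suc j) + 1) ∸ 4) / 3)
  count-four-power-minus-one = subst (CountAbSqFactors m) (sym count≡) count-abelian-squares

-- The case n = 1 of the second family, m = 3: at scale 1 every factor of
-- length 6 is itself a window, and the four abelian squares among the 16
-- factors of length 6 are found by direct computation.
count-length-six : CountAbSqFactors (4 ^ 1 ∸ 1) ((4 ^ (1 + 1) ∸ 4) / 3)
count-length-six = Counting.count-abelian-squares cover
  where
  cover : BlockCover 0 3
  cover = record
    { window          = λ _ → 5
    ; 0<m             = s≤s z≤n
    ; synchronizing   = ≤ᵇ⇒≤ 6 12 _
    ; reaches         = λ { zero _ → ≤-refl ; (suc _) (s≤s ()) }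
    ; within          = λ { zero _ → ≤-refl ; (suc _) (s≤s ()) }
    ; representatives = λ _ → reps6
    }

corollary10 : ∀ (n : ℕ) → n ≥ 1 →
    CountAbSqFactors (4 ^ n ∸ 1) ((4 ^ (n + 1) ∸ 4) / 3)
    × CountAbSqFactors (3 * 2 ^ n) (14 * 2 ^ n ∸ 4)
corollary10 (suc zero)    _ = count-length-six , ThreeTimesPowerOfTwo.count-three-times-power zero
corollary10 (suc (suc j)) _ = FourPowerMinusOne.count-four-power-minus-one j , ThreeTimesPowerOfTwo.count-three-times-power (suc j)
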